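{- For integers $k,l,m>0$, $$\mathrm{UF}\bigl(x;\mathcal{P}_{k,l}^{\langle m\rangle}\bigr) = 1+(k+l)m\,x+(k+l)\binom{m}{2}x^{2}+m\,x^{l+1} = \mathrm{LF}\bigl(x;\mathcal{P}_{k,l}^{\langle m\rangle}\bigr).$$
   Context: $\mathcal{P}_{k,l}$ is the bounded poset whose proper part (the poset with least and greatest elements removed) is the disjoint union of a $k$-element chain and an $l$-element antichain. For a finite bounded poset $\mathcal{P}$ with least element $\hat0$ and $m>0$, the $m$-cover poset $\mathcal{P}^{\langle m\rangle}$ is the subposet of the componentwise-ordered direct product $\mathcal{P}^m$ consisting of the multichains $x_1\le\cdots\le x_m$ such that $\{x_1,\dots,x_m\}\setminus\{\hat0\}$ is empty, a single element, or $\{p,q\}$ with $p\lessdot q$. For a finite poset $\mathcal Q$, $\mathrm{UF}(x;\mathcal Q)=\sum_{n\ge0}u_nx^n$ where $u_n$ is the number of elements of $\mathcal Q$ with exactly $n$ upper covers, and $\mathrm{LF}(x;\mathcal Q)=\sum_{n\ge0}l_nx^n$ where $l_n$ is the number of elements with exactly $n$ lower covers. -}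

module Defs where

open import Data.Nat using (ℕ; zero; suc; _+_; _*_; _≡ᵇ_)
open import Data.Nat.Combinatorics using (_C_)
open import Data.Bool using (Bool; true; false; _∧_; _∨_; not; if_then_else_)
open import Data.Fin using (Fin; toℕ)
open import Data.Fin.Properties using () renaming (_≟_ to _≟F_)
open import Data.List using (List; []; _∷_; map; filter; length; concatMap; allFin)
open import Data.Bool.ListAction using (any)
open import Data.Vec using (Vec; []; _∷_; zipWith; foldr)
open import Relation.Nullary.Decidable using (does)
open import Relation.Binary.PropositionalEquality using (_≡_)
open import Data.Bool using (T)
open import Data.Bool.Properties using (T?)

-- Generic machinery: a finite poset given by a complete, duplicate-free
-- enumeration `elems`, a decidable order `leq`, decidable equality `eq`,
-- and least element `bot`.

module FinitePoset {A : Set} (elems : List A) (leq : A → A → Bool)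
                   (eq : A → A → Bool) (bot : A) where

  lt : A → A → Bool
  lt p q = leq p q ∧ not (eq p q)

  cov : A → A → Bool
  cov p q = lt p q ∧ not (any (λ r → lt p r ∧ lt r q) elems)

  tuples : (m : ℕ) → List (Vec A m)
  tuples zero    = [] ∷ []
  tuples (suc m) = concatMap (λ a → map (a ∷_) (tuples m)) elems

  leqV : {m : ℕ} → Vec A m → Vec A m → Bool
  leqV xs ys = foldr _ _∧_ true (zipWith leq xs ys)

  eqV : {m : ℕ} → Vec A m → Vec A m → Bool
  eqV xs ys = foldr _ _∧_ true (zipWith eq xs ys)

  ltV : {m : ℕ} → Vec A m → Vec A m → Bool
  ltV xs ys = leqV xs ys ∧ not (eqV xs ys)

  multichain : {m : ℕ} → Vec A m → Bool
  multichain []             = true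
  multichain (x ∷ [])       = true
  multichain (x ∷ y ∷ xs)   = leq x y ∧ multichain (y ∷ xs)

  allV : {m : ℕ} → (A → Bool) → Vec A m → Bool
  allV P xs = foldr _ (λ x b → P x ∧ b) true xs

  anyV : {m : ℕ} → (A → Bool) → Vec A m → Bool
  anyV P xs = foldr _ (λ x b → P x ∨ b) false xs

  nonBot : A → Bool
  nonBot x = not (eq x bot)

  supportAtMostOne : {m : ℕ} → Vec A m → Bool
  supportAtMostOne xs =
    allV (λ x → allV (λ y → not (nonBot x) ∨ not (nonBot y) ∨ eq x y) xs) xs

  supportCoverPair : {m : ℕ} → Vec A m → Bool
  supportCoverPair xs =
    any (λ p → any (λ q →
         cov p q
       ∧ allV (λ x → not (nonBot x) ∨ eq x p ∨ eq x q) xs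
       ∧ anyV (λ x → eq x p) xs
       ∧ anyV (λ x → eq x q) xs) elems) elems

  inCoverPoset : {m : ℕ} → Vec A m → Bool
  inCoverPoset xs = multichain xs ∧ (supportAtMostOne xs ∨ supportCoverPair xs)

  coverPoset : (m : ℕ) → List (Vec A m)
  coverPoset m = filter (λ xs → T? (inCoverPoset xs)) (tuples m)

  -- y covers x in the subposet Q = P^⟨m⟩ (covers taken inside Q)
  covQ : (m : ℕ) → Vec A m → Vec A m → Bool
  covQ m x y = ltV x y ∧ not (any (λ z → ltV x z ∧ ltV z y) (coverPoset m))

  numUpperCovers : (m : ℕ) → Vec A m → ℕ
  numUpperCovers m x = length (filter (λ y → T? (covQ m x y)) (coverPoset m))

  numLowerCovers : (m : ℕ) → Vec A m → ℕ
  numLowerCovers m x = length (filter (λ y → T? (covQ m y x)) (coverPoset m))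

  -- n-th coefficient of UF(x; P^⟨m⟩) and LF(x; P^⟨m⟩)
  UFcoeff : (m : ℕ) → ℕ → ℕ
  UFcoeff m n = length (filter (λ x → T? (numUpperCovers m x ≡ᵇ n)) (coverPoset m))

  LFcoeff : (m : ℕ) → ℕ → ℕ
  LFcoeff m n = length (filter (λ x → T? (numLowerCovers m x ≡ᵇ n)) (coverPoset m))

-- The poset P_{k,l}: 0̂, 1̂, a k-chain c₀ < ⋯ < c_{k-1}, an l-antichain.

data Pkl (k l : ℕ) : Set where
  bot : Pkl k l
  top : Pkl k l
  ch  : Fin k → Pkl k l
  an  : Fin l → Pkl k l

module _ {k l : ℕ} where

  allPkl : List (Pkl k l)
  allPkl = bot ∷ top ∷ (map ch (allFin k) Data.List.++ map an (allFin l))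

  leqPkl : Pkl k l → Pkl k l → Bool
  leqPkl bot    _      = true
  leqPkl _      top    = true
  leqPkl (ch i) (ch j) = toℕ i Data.Nat.≤ᵇ toℕ j
  leqPkl (an i) (an j) = does (i ≟F j)
  leqPkl _      _      = false

  eqPkl : Pkl k l → Pkl k l → Bool
  eqPkl bot    bot    = true
  eqPkl top    top    = true
  eqPkl (ch i) (ch j) = does (i ≟F j)
  eqPkl (an i) (an j) = does (i ≟F j)
  eqPkl _      _      = false

module PklPoset (k l : ℕ) = FinitePoset (allPkl {k} {l}) leqPkl eqPkl bot

UF-Pkl : (k l m : ℕ) → ℕ → ℕ
UF-Pkl k l m = PklPoset.UFcoeff k l m

LF-Pkl : (k l m : ℕ) → ℕ → ℕ
LF-Pkl k l m = PklPoset.LFcoeff k l m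

[_≡?_] : ℕ → ℕ → ℕ
[ a ≡? b ] = if a ≡ᵇ b then 1 else 0

rhsCoeff : (k l m : ℕ) → ℕ → ℕ
rhsCoeff k l m n =
    [ n ≡? 0 ] * 1
  + [ n ≡? 1 ] * ((k + l) * m)
  + [ n ≡? 2 ] * ((k + l) * (m C 2))
  + [ n ≡? (l + 1) ] * m

-- Since k > 0, every proper element p of P_{k,l} has a unique upper cover p⁺ and a unique lower
-- cover. Hence every element of P_{k,l}^⟨m⟩ is a staircase 0̂ᵘ qᵐ⁻ᵘ with q ∈ {0̂, 1̂, p}, or
-- 0̂ᵘ pᵛ⁻ᵘ (p⁺)ᵐ⁻ᵛ with u < v < m, and the covers of each staircase can be listed. 0̂ᵐ has the l + 1
-- upper covers 0̂ᵐ⁻¹a (a an atom) and no lower cover; 0̂ᵘ1̂ᵐ⁻ᵘ has one upper cover 0̂ᵘ⁻¹r1̂ᵐ⁻ᵘ per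
-- coatom r when u > 0, none when u = 0, and one lower cover 0̂ᵘr1̂ᵐ⁻ᵘ⁻¹ per coatom; the staircases
-- 0̂ᵘpᵐ⁻ᵘ and 0̂ᵘpᵛ⁻ᵘ(p⁺)ᵐ⁻ᵛ have one upper cover if u = 0 and two otherwise, and one and two lower
-- covers respectively. Counting staircases by these numbers gives both polynomials.

module Submission where

open import Defs
open import Data.Bool using (Bool; true; false; T; not; _∧_; _∨_; if_then_else_)
open import Data.Bool.Properties using (T?; T-∧; T-∨; not-involutive)
open import Data.Empty using (⊥; ⊥-elim)
open import Data.List using (List; []; _∷_; _++_; map; concatMap; filter; length; allFin; upTo)
open import Data.List.Properties using (length-map; length-tabulate; length-++; length-upTo; map-applyUpTo; upTo-∷ʳ)
open import Data.List.Membership.Propositional using (_∈_; find; lose)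
open import Data.List.Membership.Propositional.Properties
  using (∈-concatMap⁺; ∈-concatMap⁻; ∈-map⁺; ∈-map⁻; ∈-++⁺ˡ; ∈-++⁺ʳ; ∈-++⁻; ∈-filter⁺; ∈-filter⁻; ∈-allFin; ∈-upTo⁺; ∈-upTo⁻)
open import Data.List.Membership.Propositional.Properties.WithK using (unique∧set⇒bag)
open import Data.List.Relation.Binary.BagAndSetEquality using (∼bag⇒↭)
open import Data.List.Relation.Binary.Permutation.Propositional.Properties using (↭-length)
open import Data.List.Relation.Unary.All as All using ([]; _∷_)
open import Data.List.Relation.Unary.Any using (here; there)
open import Data.List.Relation.Unary.Any.Properties using (any⁺; any⁻)
open import Data.List.Relation.Unary.Unique.Propositional using (Unique; []; _∷_)
open import Data.List.Relation.Unary.Unique.Propositional.Properties using (++⁺; map⁺; filter⁺; allFin⁺; upTo⁺)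
open import Data.Fin using (Fin; toℕ; fromℕ; fromℕ<; inject₁) renaming (zero to fzero; suc to fsuc)
open import Data.Fin.Properties using (toℕ-injective; toℕ-fromℕ; toℕ-fromℕ<; toℕ-inject₁; toℕ<n) renaming (_≟_ to _≟ᶠ_)
open import Data.Nat using (ℕ; zero; suc; pred; _+_; _*_; _≤_; _<_; z≤n; s≤s; _<?_; _≤?_; _≡ᵇ_)
open import Data.Nat.ListAction using (sum)
open import Data.Nat.Combinatorics using (_C_; nC1≡n; nCk+nC[k+1]≡[n+1]C[k+1])
open import Data.Nat.Tactic.RingSolver using (solve-∀)
open import Data.Nat.Properties
  using ( +-assoc; +-comm; <-cmp; 1+n≢n; ≤∧≢⇒<; ≤ᵇ⇒≤; ≤⇒≤ᵇ; ≤-antisym; ≤-refl; ≤-trans; <⇒≤; <-≤-trans; ≤-<-trans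
        ; <-trans; n≮n; ≮⇒≥; ≰⇒>; ≤-pred; n≤1+n; pred-mono-≤)
open import Data.Product using (_×_; _,_; proj₁; proj₂; ∃-syntax)
open import Data.Sum using (_⊎_; inj₁; inj₂; [_,_]′)
import Data.Sum as Sum
open import Data.Unit using (⊤; tt)
open import Data.Vec using (Vec; []; _∷_)
open import Function using (_∘_; flip; case_of_)
open import Function.Bundles using (_⇔_; mk⇔; Equivalence)
open import Relation.Binary.PropositionalEquality using (_≡_; _≢_; refl; sym; trans; cong; cong₂; subst; subst₂; module ≡-Reasoning)
open import Relation.Binary.Structures using (IsPartialOrder)
open import Relation.Binary.Definitions using (tri<; tri≈; tri>)
open import Relation.Binary.PropositionalEquality.Properties using (isEquivalence)
open import Relation.Nullary using (¬_; Dec; yes; no; does)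
open import Relation.Nullary.Decidable using (map′)

open Equivalence using (to; from)

T-∧⁺ : ∀ {a b} → T a → T b → T (a ∧ b)
T-∧⁺ ta tb = from T-∧ (ta , tb)

T-∧⁻ : ∀ {a b} → T (a ∧ b) → T a × T b
T-∧⁻ = to T-∧

T-∨⁻ : ∀ {a b} → T (a ∨ b) → T a ⊎ T b
T-∨⁻ = to T-∨

T-∨⁺ˡ : ∀ {a b} → T a → T (a ∨ b)
T-∨⁺ˡ = from T-∨ ∘ inj₁

T-∨⁺ʳ : ∀ {a b} → T b → T (a ∨ b)
T-∨⁺ʳ = from T-∨ ∘ inj₂

T-not⁺ : ∀ {a} → ¬ T a → T (not a)
T-not⁺ {false} _ = tt
T-not⁺ {true}  h = h tt

T-not⁻ : ∀ {a} → T (not a) → ¬ T a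
T-not⁻ {false} _ ()

T-∨₃⇔ : ∀ {a b c} {P Q R : Set} → T a ⇔ P → T b ⇔ Q → T c ⇔ R → T (a ∨ b ∨ c) ⇔ (P ⊎ Q ⊎ R)
T-∨₃⇔ {a} {b} {c} a⇔P b⇔Q c⇔R = mk⇔
  (λ h → Sum.map (to a⇔P) (Sum.map (to b⇔Q) (to c⇔R) ∘ T-∨⁻ {b}) (T-∨⁻ {a} h))
  [ T-∨⁺ˡ {a} ∘ from a⇔P , [ T-∨⁺ʳ {a} ∘ T-∨⁺ˡ {b} ∘ from b⇔Q , T-∨⁺ʳ {a} ∘ T-∨⁺ʳ {b} ∘ from c⇔R ]′ ]′

unique∧set⇒length≡ : ∀ {A : Set} {xs ys : List A} → Unique xs → Unique ys →
                     (∀ {z} → z ∈ xs → z ∈ ys) → (∀ {z} → z ∈ ys → z ∈ xs) → length xs ≡ length ys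
unique∧set⇒length≡ xs! ys! xs⊆ys ys⊆xs = ↭-length (∼bag⇒↭ (unique∧set⇒bag xs! ys! (mk⇔ xs⊆ys ys⊆xs)))

module _ {A B : Set} where

  concatMap-unique : ∀ (g : A → List B) {xs} → Unique xs → (∀ x → Unique (g x)) →
                     (∀ {x x' z} → z ∈ g x → z ∈ g x' → x ≡ x') → Unique (concatMap g xs)
  concatMap-unique g {[]}     _           _    _        = []
  concatMap-unique g {x ∷ xs} (x∉ ∷ xs!) g-un disjoint =
    ++⁺ (g-un x) (concatMap-unique g xs! g-un disjoint) λ (z∈gx , z∈rest) →
      let y , y∈xs , z∈gy = find (∈-concatMap⁻ g z∈rest) in All.lookup x∉ y∈xs (disjoint z∈gx z∈gy)

  map-unique : ∀ (f : A → B) {xs} → Unique xs → (∀ {x y} → x ∈ xs → y ∈ xs → f x ≡ f y → x ≡ y) →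
               Unique (map f xs)
  map-unique f {[]}     _          _   = []
  map-unique f {x ∷ xs} (x∉ ∷ xs!) inj =
    All.tabulate fresh ∷ map-unique f xs! (λ x∈ y∈ → inj (there x∈) (there y∈))
    where
    fresh : ∀ {z} → z ∈ map f xs → f x ≢ z
    fresh z∈ fx≡z with ∈-map⁻ f z∈
    ... | y , y∈xs , refl = All.lookup x∉ y∈xs (inj (here refl) (there y∈xs) fx≡z)

∑ : ∀ {A : Set} → (A → ℕ) → List A → ℕ
∑ f xs = sum (map f xs)

module _ {A : Set} where

  ∑-++ : ∀ (f : A → ℕ) xs ys → ∑ f (xs ++ ys) ≡ ∑ f xs + ∑ f ys
  ∑-++ f []       ys = refl
  ∑-++ f (x ∷ xs) ys = trans (cong (f x +_) (∑-++ f xs ys)) (sym (+-assoc (f x) _ _))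

  ∑-cong : ∀ {f g : A → ℕ} xs → (∀ x → x ∈ xs → f x ≡ g x) → ∑ f xs ≡ ∑ g xs
  ∑-cong []       _   = refl
  ∑-cong (x ∷ xs) f≡g = cong₂ _+_ (f≡g x (here refl)) (∑-cong xs (λ y y∈ → f≡g y (there y∈)))

  ∑-const : ∀ c (xs : List A) → ∑ (λ _ → c) xs ≡ length xs * c
  ∑-const c []       = refl
  ∑-const c (x ∷ xs) = cong (c +_) (∑-const c xs)

  length-filter≡∑ : ∀ (f : A → Bool) xs → length (filter (T? ∘ f) xs) ≡ ∑ (λ x → if f x then 1 else 0) xs
  length-filter≡∑ f []       = refl
  length-filter≡∑ f (x ∷ xs) with f x
  ... | true  = cong suc (length-filter≡∑ f xs)
  ... | false = length-filter≡∑ f xs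

module _ {A B : Set} where

  ∑-map : ∀ (f : B → ℕ) (g : A → B) xs → ∑ f (map g xs) ≡ ∑ (f ∘ g) xs
  ∑-map f g []       = refl
  ∑-map f g (x ∷ xs) = cong (f (g x) +_) (∑-map f g xs)

  ∑-concatMap : ∀ (f : B → ℕ) (g : A → List B) xs → ∑ f (concatMap g xs) ≡ ∑ (∑ f ∘ g) xs
  ∑-concatMap f g []       = refl
  ∑-concatMap f g (x ∷ xs) = trans (∑-++ f (g x) (concatMap g xs)) (cong (∑ f (g x) +_) (∑-concatMap f g xs))

≡ᵇ-comm : ∀ a b → (a ≡ᵇ b) ≡ (b ≡ᵇ a)
≡ᵇ-comm zero    zero    = refl
≡ᵇ-comm zero    (suc b) = refl
≡ᵇ-comm (suc a) zero    = refl
≡ᵇ-comm (suc a) (suc b) = ≡ᵇ-comm a b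

∑-upTo-suc : ∀ (f : ℕ → ℕ) n → ∑ f (upTo (suc n)) ≡ f 0 + ∑ (f ∘ suc) (upTo n)
∑-upTo-suc f n = cong (f 0 +_) (trans (cong (∑ f) (sym (map-applyUpTo (λ i → i) suc n))) (∑-map f suc (upTo n)))

∑-upTo-const : ∀ c n → ∑ (λ _ → c) (upTo n) ≡ n * c
∑-upTo-const c n = trans (∑-const c (upTo n)) (cong (_* c) (length-upTo n))

suc-C2 : ∀ n → suc n C 2 ≡ n + (n C 2)
suc-C2 n = sym (trans (cong (_+ n C 2) (sym (nC1≡n n))) (nCk+nC[k+1]≡[n+1]C[k+1] n 1))

∑-upTo-linear : ∀ a b n → ∑ (λ w → a + w * b) (upTo n) ≡ n * a + (n C 2) * b
∑-upTo-linear a b zero    = refl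
∑-upTo-linear a b (suc n) = begin
  ∑ f (upTo (suc n))                    ≡⟨ cong (∑ f) (sym (upTo-∷ʳ n)) ⟩
  ∑ f (upTo n ++ n ∷ [])                ≡⟨ ∑-++ f (upTo n) (n ∷ []) ⟩
  ∑ f (upTo n) + (f n + 0)              ≡⟨ cong (_+ (f n + 0)) (∑-upTo-linear a b n) ⟩
  n * a + (n C 2) * b + (a + n * b + 0)   ≡⟨ step a b n (n C 2) ⟩
  suc n * a + (n + n C 2) * b           ≡⟨ cong (λ c → suc n * a + c * b) (sym (suc-C2 n)) ⟩
  suc n * a + (suc n C 2) * b             ∎
  where
  open ≡-Reasoning
  f : ℕ → ℕ
  f w = a + w * b
  step : ∀ a b n c → n * a + c * b + (a + n * b + 0) ≡ suc n * a + (n + c) * b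
  step = solve-∀

data Region (u v t : ℕ) : Set where
  low  : t < u → Region u v t
  mid  : u ≤ t → t < v → Region u v t
  high : u ≤ t → v ≤ t → Region u v t

region : ∀ u v t → Region u v t
region u v t with t <? u | t <? v
... | yes t<u | _       = low t<u
... | no t≮u  | yes t<v = mid (≮⇒≥ t≮u) t<v
... | no t≮u  | no t≮v  = high (≮⇒≥ t≮u) (≮⇒≥ t≮v)

-- The m-cover poset of a finite poset with a least element

module CoverPoset
  {A : Set} (elems : List A) (leq eq : A → A → Bool) (0̂ : A)
  {_⊑_ : A → A → Set} (⊑-isPartialOrder : IsPartialOrder _≡_ _⊑_)
  (leq⇔⊑ : ∀ {x y} → T (leq x y) ⇔ x ⊑ y)
  (eq⇔≡ : ∀ {x y} → T (eq x y) ⇔ x ≡ y)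
  (0̂-least : ∀ x → 0̂ ⊑ x)
  (∈-elems : ∀ x → x ∈ elems)
  (elems-unique : Unique elems)
  where

  open FinitePoset elems leq eq 0̂ public
  open IsPartialOrder ⊑-isPartialOrder public
    using () renaming (refl to ⊑-refl; trans to ⊑-trans; antisym to ⊑-antisym; reflexive to ⊑-reflexive)

  infix 4 _⊏_ _⋖_

  _⊏_ : A → A → Set
  x ⊏ y = x ⊑ y × x ≢ y

  _⋖_ : A → A → Set
  x ⋖ y = x ⊏ y × (∀ r → x ⊑ r → r ⊑ y → r ≡ x ⊎ r ≡ y)

  _≟_ : (x y : A) → Dec (x ≡ y)
  x ≟ y = map′ (to eq⇔≡) (from eq⇔≡) (T? (eq x y))

  ⊑0̂⇒≡0̂ : ∀ {x} → x ⊑ 0̂ → x ≡ 0̂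
  ⊑0̂⇒≡0̂ x⊑0̂ = ⊑-antisym x⊑0̂ (0̂-least _)

  lt⇔⊏ : ∀ {x y} → T (lt x y) ⇔ x ⊏ y
  lt⇔⊏ = mk⇔ (λ h → let x≤y , x≠y = T-∧⁻ h in to leq⇔⊑ x≤y , T-not⁻ x≠y ∘ from eq⇔≡)
             (λ (x⊑y , x≢y) → T-∧⁺ (from leq⇔⊑ x⊑y) (T-not⁺ (x≢y ∘ to eq⇔≡)))

  cov⇔⋖ : ∀ {x y} → T (cov x y) ⇔ x ⋖ y
  cov⇔⋖ {x} {y} = mk⇔ sound complete
    where
    sound : T (cov x y) → x ⋖ y
    sound h = to lt⇔⊏ x<y , between
      where
      x<y : T (lt x y)
      x<y = proj₁ (T-∧⁻ h)
      between : ∀ r → x ⊑ r → r ⊑ y → r ≡ x ⊎ r ≡ y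
      between r x⊑r r⊑y with r ≟ x | r ≟ y
      ... | yes r≡x | _       = inj₁ r≡x
      ... | no _    | yes r≡y = inj₂ r≡y
      ... | no r≢x  | no r≢y  = ⊥-elim (T-not⁻ (proj₂ (T-∧⁻ h)) (any⁺ _ (lose (∈-elems r)
                                  (T-∧⁺ (from lt⇔⊏ (x⊑r , r≢x ∘ sym)) (from lt⇔⊏ (r⊑y , r≢y))))))
    complete : x ⋖ y → T (cov x y)
    complete (x⊏y , between) = T-∧⁺ (from lt⇔⊏ x⊏y) (T-not⁺ λ h →
      let r , _ , t = find (any⁻ _ elems h)
          x<r , r<y = T-∧⁻ {lt x r} t
          x⊑r , x≢r = to lt⇔⊏ x<r
          r⊑y , r≢y = to lt⇔⊏ r<y
      in [ x≢r ∘ sym , r≢y ]′ (between r x⊑r r⊑y))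

  ⊏-least⇒⋖ : ∀ {x y} → x ⊏ y → (∀ {s} → x ⊏ s → y ⊑ s) → x ⋖ y
  ⊏-least⇒⋖ {x} {y} x⊏y least = x⊏y , between
    where
    between : ∀ r → x ⊑ r → r ⊑ y → r ≡ x ⊎ r ≡ y
    between r x⊑r r⊑y with r ≟ x
    ... | yes r≡x = inj₁ r≡x
    ... | no r≢x  = inj₂ (⊑-antisym r⊑y (least (x⊑r , r≢x ∘ sym)))

  ⊏-greatest⇒⋖ : ∀ {x y} → x ⊏ y → (∀ {s} → s ⊏ y → s ⊑ x) → x ⋖ y
  ⊏-greatest⇒⋖ {x} {y} x⊏y greatest = x⊏y , between
    where
    between : ∀ r → x ⊑ r → r ⊑ y → r ≡ x ⊎ r ≡ y
    between r x⊑r r⊑y with r ≟ y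
    ... | yes r≡y = inj₂ r≡y
    ... | no r≢y  = inj₁ (⊑-antisym (greatest (r⊑y , r≢y)) x⊑r)

  ⋖-above : ∀ {x y q} → x ⋖ y → x ⊏ q → q ⊑ y → q ≡ y
  ⋖-above (_ , between) (x⊑q , x≢q) q⊑y with between _ x⊑q q⊑y
  ... | inj₁ q≡x = ⊥-elim (x≢q (sym q≡x))
  ... | inj₂ q≡y = q≡y

  ⋖-below : ∀ {x y q} → x ⋖ y → x ⊑ q → q ⊏ y → q ≡ x
  ⋖-below (_ , between) x⊑q (q⊑y , q≢y) with between _ x⊑q q⊑y
  ... | inj₁ q≡x = q≡x
  ... | inj₂ q≡y = ⊥-elim (q≢y q≡y)

  -- Entries are indexed by ℕ; out-of-range indices read as 0̂.
  infixl 30 _!_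
  _!_ : ∀ {m} → Vec A m → ℕ → A
  []      ! _     = 0̂
  (a ∷ _) ! zero  = a
  (_ ∷ w) ! suc t = w ! t

  Vec-ext : ∀ {m} {a b : Vec A m} → (∀ t → t < m → a ! t ≡ b ! t) → a ≡ b
  Vec-ext {a = []}    {[]}    _   = refl
  Vec-ext {a = _ ∷ _} {_ ∷ _} a≗b = cong₂ _∷_ (a≗b 0 (s≤s z≤n)) (Vec-ext (λ t t<m → a≗b (suc t) (s≤s t<m)))

  ≢-at : ∀ {m} {a b : Vec A m} t → a ! t ≢ b ! t → a ≢ b
  ≢-at _ ne refl = ne refl

  infix 4 _⊑ᵥ_ _⊏ᵥ_

  _⊑ᵥ_ : ∀ {m} → Vec A m → Vec A m → Set
  _⊑ᵥ_ {m} a b = ∀ t → t < m → a ! t ⊑ b ! t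

  _⊏ᵥ_ : ∀ {m} → Vec A m → Vec A m → Set
  a ⊏ᵥ b = a ⊑ᵥ b × a ≢ b

  ⊑ᵥ-refl : ∀ {m} (a : Vec A m) → a ⊑ᵥ a
  ⊑ᵥ-refl _ _ _ = ⊑-refl

  ⊑ᵥ-trans : ∀ {m} {a b c : Vec A m} → a ⊑ᵥ b → b ⊑ᵥ c → a ⊑ᵥ c
  ⊑ᵥ-trans a⊑b b⊑c t t<m = ⊑-trans (a⊑b t t<m) (b⊑c t t<m)

  ⊑ᵥ-antisym : ∀ {m} {a b : Vec A m} → a ⊑ᵥ b → b ⊑ᵥ a → a ≡ b
  ⊑ᵥ-antisym a⊑b b⊑a = Vec-ext (λ t t<m → ⊑-antisym (a⊑b t t<m) (b⊑a t t<m))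

  ⊏ᵥ⇒⋢ᵥ : ∀ {m} {a b : Vec A m} → a ⊏ᵥ b → ¬ b ⊑ᵥ a
  ⊏ᵥ⇒⋢ᵥ (a⊑b , a≢b) b⊑a = a≢b (⊑ᵥ-antisym a⊑b b⊑a)

  leqV⇔⊑ᵥ : ∀ {m} (a b : Vec A m) → T (leqV a b) ⇔ a ⊑ᵥ b
  leqV⇔⊑ᵥ a b = mk⇔ (sound a b) (complete a b)
    where
    sound : ∀ {m} (a b : Vec A m) → T (leqV a b) → a ⊑ᵥ b
    sound (x ∷ _) (y ∷ _) h zero    _         = to leq⇔⊑ (proj₁ (T-∧⁻ {leq x y} h))
    sound (x ∷ a) (y ∷ b) h (suc t) (s≤s t<m) = sound a b (proj₂ (T-∧⁻ {leq x y} h)) t t<m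
    complete : ∀ {m} (a b : Vec A m) → a ⊑ᵥ b → T (leqV a b)
    complete []      []      _   = tt
    complete (_ ∷ a) (_ ∷ b) a⊑b =
      T-∧⁺ (from leq⇔⊑ (a⊑b 0 (s≤s z≤n))) (complete a b (λ t t<m → a⊑b (suc t) (s≤s t<m)))

  eqV⇔≡ : ∀ {m} (a b : Vec A m) → T (eqV a b) ⇔ a ≡ b
  eqV⇔≡ a b = mk⇔ (sound a b) (λ { refl → reflexive a })
    where
    sound : ∀ {m} (a b : Vec A m) → T (eqV a b) → a ≡ b
    sound []      []      _ = refl
    sound (x ∷ a) (y ∷ b) h = cong₂ _∷_ (to eq⇔≡ (proj₁ (T-∧⁻ {eq x y} h))) (sound a b (proj₂ (T-∧⁻ {eq x y} h)))
    reflexive : ∀ {m} (a : Vec A m) → T (eqV a a)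
    reflexive []      = tt
    reflexive (x ∷ a) = T-∧⁺ (from eq⇔≡ refl) (reflexive a)

  ltV⇔⊏ᵥ : ∀ {m} (a b : Vec A m) → T (ltV a b) ⇔ a ⊏ᵥ b
  ltV⇔⊏ᵥ a b =
    mk⇔ (λ h → let a≤b , a≠b = T-∧⁻ {leqV a b} h in to (leqV⇔⊑ᵥ a b) a≤b , T-not⁻ a≠b ∘ from (eqV⇔≡ a b))
        (λ (a⊑b , a≢b) → T-∧⁺ (from (leqV⇔⊑ᵥ a b) a⊑b) (T-not⁺ (a≢b ∘ to (eqV⇔≡ a b))))

  Monotone : ∀ {m} → Vec A m → Set
  Monotone {m} v = ∀ s t → s ≤ t → t < m → v ! s ⊑ v ! t

  multichain⇒monotone : ∀ {m} (v : Vec A m) → T (multichain v) → Monotone v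
  multichain⇒monotone (x ∷ [])     _ zero    zero    _         _               = ⊑-refl
  multichain⇒monotone (x ∷ [])     _ _       (suc _) _         (s≤s ())
  multichain⇒monotone (x ∷ y ∷ xs) h zero    zero    _         _               = ⊑-refl
  multichain⇒monotone (x ∷ y ∷ xs) h zero    (suc t) _         (s≤s t<m)       =
    ⊑-trans (to leq⇔⊑ (proj₁ (T-∧⁻ {leq x y} h)))
            (multichain⇒monotone (y ∷ xs) (proj₂ (T-∧⁻ {leq x y} h)) zero t z≤n t<m)
  multichain⇒monotone (x ∷ y ∷ xs) h (suc s) (suc t) (s≤s s≤t) (s≤s t<m)       =
    multichain⇒monotone (y ∷ xs) (proj₂ (T-∧⁻ {leq x y} h)) s t s≤t t<m

  successive⇒multichain : ∀ {m} (v : Vec A m) → (∀ t → suc t < m → v ! t ⊑ v ! suc t) → T (multichain v)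
  successive⇒multichain []           _    = tt
  successive⇒multichain (x ∷ [])     _    = tt
  successive⇒multichain (x ∷ y ∷ xs) step =
    T-∧⁺ (from leq⇔⊑ (step 0 (s≤s (s≤s z≤n)))) (successive⇒multichain (y ∷ xs) (λ t t<m → step (suc t) (s≤s t<m)))

  isZero⇔≡0̂ : ∀ {x} → T (not (nonBot x)) ⇔ x ≡ 0̂
  isZero⇔≡0̂ {x} = subst (λ b → T b ⇔ x ≡ 0̂) (sym (not-involutive (eq x 0̂))) eq⇔≡

  allV⇔ : ∀ {m} (P : A → Bool) (v : Vec A m) → T (allV P v) ⇔ (∀ t → t < m → T (P (v ! t)))
  allV⇔ P v = mk⇔ (sound v) (complete v)
    where
    sound : ∀ {m} (v : Vec A m) → T (allV P v) → ∀ t → t < m → T (P (v ! t))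
    sound (x ∷ v) h zero    _         = proj₁ (T-∧⁻ {P x} h)
    sound (x ∷ v) h (suc t) (s≤s t<m) = sound v (proj₂ (T-∧⁻ {P x} h)) t t<m
    complete : ∀ {m} (v : Vec A m) → (∀ t → t < m → T (P (v ! t))) → T (allV P v)
    complete []      _  = tt
    complete (x ∷ v) Pv = T-∧⁺ (Pv 0 (s≤s z≤n)) (complete v (λ t t<m → Pv (suc t) (s≤s t<m)))

  anyV⁺ : ∀ {m} (P : A → Bool) (v : Vec A m) t → t < m → T (P (v ! t)) → T (anyV P v)
  anyV⁺ P (x ∷ v) zero    _         Pvt = T-∨⁺ˡ {P x} Pvt
  anyV⁺ P (x ∷ v) (suc t) (s≤s t<m) Pvt = T-∨⁺ʳ {P x} (anyV⁺ P v t t<m Pvt)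

  SupportedBy : A → A → A → Set
  SupportedBy p q a = a ≡ 0̂ ⊎ a ≡ p ⊎ a ≡ q

  supportAtMostOne⇒ : ∀ {m} (v : Vec A m) → T (supportAtMostOne v) →
                      ∀ s t → s < m → t < m → v ! s ≢ 0̂ → v ! t ≢ 0̂ → v ! s ≡ v ! t
  supportAtMostOne⇒ v h s t s<m t<m vs≢0̂ vt≢0̂
    with to (T-∨₃⇔ isZero⇔≡0̂ isZero⇔≡0̂ eq⇔≡) (to (allV⇔ _ v) (to (allV⇔ _ v) h s s<m) t t<m)
  ... | inj₁ vs≡0̂        = ⊥-elim (vs≢0̂ vs≡0̂)
  ... | inj₂ (inj₁ vt≡0̂) = ⊥-elim (vt≢0̂ vt≡0̂)
  ... | inj₂ (inj₂ vs≡vt) = vs≡vt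

  supportAtMostOne⇐ : ∀ {m} (v : Vec A m) q → (∀ t → t < m → v ! t ≡ 0̂ ⊎ v ! t ≡ q) → T (supportAtMostOne v)
  supportAtMostOne⇐ v q v⊆0̂q = from (allV⇔ _ v) λ s s<m → from (allV⇔ _ v) λ t t<m →
    from (T-∨₃⇔ isZero⇔≡0̂ isZero⇔≡0̂ eq⇔≡) (agree (v⊆0̂q s s<m) (v⊆0̂q t t<m))
    where
    agree : ∀ {a b} → a ≡ 0̂ ⊎ a ≡ q → b ≡ 0̂ ⊎ b ≡ q → a ≡ 0̂ ⊎ b ≡ 0̂ ⊎ a ≡ b
    agree (inj₁ a≡0̂) _             = inj₁ a≡0̂
    agree (inj₂ _)    (inj₁ b≡0̂)   = inj₂ (inj₁ b≡0̂)
    agree (inj₂ a≡q)  (inj₂ b≡q)   = inj₂ (inj₂ (trans a≡q (sym b≡q)))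

  supportCoverPair⇒ : ∀ {m} (v : Vec A m) → T (supportCoverPair v) →
                      ∃[ p ] ∃[ q ] p ⋖ q × (∀ t → t < m → SupportedBy p q (v ! t))
  supportCoverPair⇒ v h =
    let p , _ , hp = find (any⁻ _ elems h)
        q , _ , hq = find (any⁻ _ elems hp)
        p⋖q , rest = T-∧⁻ {cov p q} hq
    in p , q , to cov⇔⋖ p⋖q ,
       λ t t<m → to (T-∨₃⇔ isZero⇔≡0̂ eq⇔≡ eq⇔≡) (to (allV⇔ _ v) (proj₁ (T-∧⁻ rest)) t t<m)

  supportCoverPair⇐ : ∀ {m} (v : Vec A m) {p q} → p ⋖ q → (∀ t → t < m → SupportedBy p q (v ! t)) →
                      ∀ s t → s < m → v ! s ≡ p → t < m → v ! t ≡ q → T (supportCoverPair v)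
  supportCoverPair⇐ v {p} {q} p⋖q v⊆0̂pq s t s<m vs≡p t<m vt≡q =
    any⁺ _ (lose (∈-elems p) (any⁺ _ (lose (∈-elems q)
      (T-∧⁺ (from cov⇔⋖ p⋖q)
       (T-∧⁺ (from (allV⇔ _ v) λ t' t'<m → from (T-∨₃⇔ isZero⇔≡0̂ eq⇔≡ eq⇔≡) (v⊆0̂pq t' t'<m))
       (T-∧⁺ (anyV⁺ _ v s s<m (from eq⇔≡ vs≡p)) (anyV⁺ _ v t t<m (from eq⇔≡ vt≡q))))))))

  ⊑ᵥ-0̂ : ∀ {m} {y x : Vec A m} {t} → y ⊑ᵥ x → t < m → x ! t ≡ 0̂ → y ! t ≡ 0̂
  ⊑ᵥ-0̂ {t = t} y⊑x t<m x-t≡0̂ = ⊑0̂⇒≡0̂ (subst (_ ⊑_) x-t≡0̂ (y⊑x t t<m))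

  monotone-below : ∀ {m} (y : Vec A m) → Monotone y → ∀ {u} → u < m → y ! u ≡ 0̂ → ∀ {t} → t < suc u → y ! t ≡ 0̂
  monotone-below y y↑ {u} u<m y-u≡0̂ {t} t<1+u = ⊑0̂⇒≡0̂ (subst (y ! t ⊑_) y-u≡0̂ (y↑ t u (≤-pred t<1+u) u<m))

  InQ : ∀ {m} → Vec A m → Set
  InQ v = T (inCoverPoset v)

  StepsAreCovers : ∀ {m} → Vec A m → Set
  StepsAreCovers {m} v = ∀ s t → s ≤ t → t < m → v ! s ≢ 0̂ → v ! s ≢ v ! t → v ! s ⋖ v ! t

  InQ⇒monotone : ∀ {m} (v : Vec A m) → InQ v → Monotone v
  InQ⇒monotone v h = multichain⇒monotone v (proj₁ (T-∧⁻ {multichain v} h))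

  supported-⊑⇒⋖ : ∀ {p q a b} → p ⋖ q → SupportedBy p q a → SupportedBy p q b →
                  a ≢ 0̂ → a ≢ b → a ⊑ b → a ⋖ b
  supported-⊑⇒⋖ _   (inj₁ refl)        _                  a≢0̂ _   _   = ⊥-elim (a≢0̂ refl)
  supported-⊑⇒⋖ _   (inj₂ _)           (inj₁ refl)        a≢0̂ _   a⊑b = ⊥-elim (a≢0̂ (⊑0̂⇒≡0̂ a⊑b))
  supported-⊑⇒⋖ _   (inj₂ (inj₁ refl)) (inj₂ (inj₁ refl)) _   a≢b _   = ⊥-elim (a≢b refl)
  supported-⊑⇒⋖ p⋖q (inj₂ (inj₁ refl)) (inj₂ (inj₂ refl)) _   _   _   = p⋖q
  supported-⊑⇒⋖ p⋖q (inj₂ (inj₂ refl)) (inj₂ (inj₁ refl)) _   _   a⊑b =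
    ⊥-elim (proj₂ (proj₁ p⋖q) (⊑-antisym (proj₁ (proj₁ p⋖q)) a⊑b))
  supported-⊑⇒⋖ _   (inj₂ (inj₂ refl)) (inj₂ (inj₂ refl)) _   a≢b _   = ⊥-elim (a≢b refl)

  InQ⇒stepsAreCovers : ∀ {m} (v : Vec A m) → InQ v → StepsAreCovers v
  InQ⇒stepsAreCovers v h s t s≤t t<m vs≢0̂ vs≢vt with T-∨⁻ {supportAtMostOne v} (proj₂ (T-∧⁻ {multichain v} h))
  ... | inj₁ sao = ⊥-elim (vs≢vt (supportAtMostOne⇒ v sao s t (≤-<-trans s≤t t<m) t<m vs≢0̂ vt≢0̂))
    where
    vt≢0̂ : v ! t ≢ 0̂
    vt≢0̂ vt≡0̂ = vs≢0̂ (⊑0̂⇒≡0̂ (subst (v ! s ⊑_) vt≡0̂ (InQ⇒monotone v h s t s≤t t<m)))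
  ... | inj₂ scp =
    let p , q , p⋖q , v⊆0̂pq = supportCoverPair⇒ v scp
    in supported-⊑⇒⋖ p⋖q (v⊆0̂pq s (≤-<-trans s≤t t<m)) (v⊆0̂pq t t<m) vs≢0̂ vs≢vt (InQ⇒monotone v h s t s≤t t<m)

  -- stairs m u v p q = 0̂ᵘ pᵛ⁻ᵘ qᵐ⁻ᵛ, with truncated exponents.
  stairs : (m u v : ℕ) → A → A → Vec A m
  stairs zero    _       _       _ _ = []
  stairs (suc m) (suc u) v       p q = 0̂ ∷ stairs m u (pred v) p q
  stairs (suc m) zero    (suc v) p q = p ∷ stairs m zero v p q
  stairs (suc m) zero    zero    p q = q ∷ stairs m zero zero p q

  module _ {p q : A} where

    stairs-low : ∀ m u v {t} → t < m → t < u → stairs m u v p q ! t ≡ 0̂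
    stairs-low (suc m) (suc u) v {zero}  _         _         = refl
    stairs-low (suc m) (suc u) v {suc t} (s≤s t<m) (s≤s t<u) = stairs-low m u (pred v) t<m t<u

    stairs-mid : ∀ m u v {t} → t < m → u ≤ t → t < v → stairs m u v p q ! t ≡ p
    stairs-mid (suc m) zero    (suc v) {zero}  _         _         _         = refl
    stairs-mid (suc m) zero    (suc v) {suc t} (s≤s t<m) _         (s≤s t<v) = stairs-mid m zero v t<m z≤n t<v
    stairs-mid (suc m) (suc u) (suc v) {suc t} (s≤s t<m) (s≤s u≤t) (s≤s t<v) = stairs-mid m u v t<m u≤t t<v

    stairs-high : ∀ m u v {t} → t < m → u ≤ t → v ≤ t → stairs m u v p q ! t ≡ q
    stairs-high (suc m) zero    zero    {zero}  _         _         _         = refl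
    stairs-high (suc m) zero    zero    {suc t} (s≤s t<m) _         _         = stairs-high m zero zero t<m z≤n z≤n
    stairs-high (suc m) zero    (suc v) {suc t} (s≤s t<m) _         (s≤s v≤t) = stairs-high m zero v t<m z≤n v≤t
    stairs-high (suc m) (suc u) v       {suc t} (s≤s t<m) (s≤s u≤t) v≤1+t     =
      stairs-high m u (pred v) t<m u≤t (pred-mono-≤ v≤1+t)

    stairs-supported : ∀ {m u v t} → t < m → SupportedBy p q (stairs m u v p q ! t)
    stairs-supported {m} {u} {v} {t} t<m with region u v t
    ... | low t<u       = inj₁ (stairs-low m u v t<m t<u)
    ... | mid u≤t t<v   = inj₂ (inj₁ (stairs-mid m u v t<m u≤t t<v))
    ... | high u≤t v≤t  = inj₂ (inj₂ (stairs-high m u v t<m u≤t v≤t))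

    stairs-successive : ∀ {m u v} → p ⊑ q → ∀ t → suc t < m → stairs m u v p q ! t ⊑ stairs m u v p q ! suc t
    stairs-successive {m} {u} {v} p⊑q t 1+t<m = step (region u v t) (region u v (suc t))
      where
      t<m : t < m
      t<m = ≤-trans (n≤1+n _) 1+t<m
      step : Region u v t → Region u v (suc t) → stairs m u v p q ! t ⊑ stairs m u v p q ! suc t
      step (low t<u)      _                = subst (_⊑ stairs m u v p q ! suc t) (sym (stairs-low m u v t<m t<u)) (0̂-least _)
      step (mid u≤t _)    (low 1+t<u)      = ⊥-elim (n≮n _ (≤-<-trans u≤t (≤-trans (n≤1+n _) 1+t<u)))
      step (mid u≤t _)    (mid _ 1+t<v)    =
        ⊑-reflexive (trans (stairs-mid m u v t<m u≤t (≤-trans (n≤1+n _) 1+t<v))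
                           (sym (stairs-mid m u v 1+t<m (≤-trans u≤t (n≤1+n _)) 1+t<v)))
      step (mid u≤t t<v)  (high _ v≤1+t)   =
        subst₂ _⊑_ (sym (stairs-mid m u v t<m u≤t t<v)) (sym (stairs-high m u v 1+t<m (≤-trans u≤t (n≤1+n _)) v≤1+t)) p⊑q
      step (high u≤t v≤t) _                =
        ⊑-reflexive (trans (stairs-high m u v t<m u≤t v≤t)
                           (sym (stairs-high m u v 1+t<m (≤-trans u≤t (n≤1+n _)) (≤-trans v≤t (n≤1+n _)))))

    stairs∈Q : ∀ m u v → p ≡ 0̂ ⊎ p ≡ q ⊎ p ⋖ q → InQ (stairs m u v p q)
    stairs∈Q m u v shape = T-∧⁺ (successive⇒multichain w (stairs-successive p⊑q)) (support shape)
      where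
      w : Vec A m
      w = stairs m u v p q
      p⊑q : p ⊑ q
      p⊑q = [ (λ p≡0̂ → subst (_⊑ q) (sym p≡0̂) (0̂-least q)) , [ ⊑-reflexive , proj₁ ∘ proj₁ ]′ ]′ shape
      only-q : (p ≡ 0̂ ⊎ p ≡ q) → ∀ t → t < m → w ! t ≡ 0̂ ⊎ w ! t ≡ q
      only-q p≡0̂∨q t t<m with stairs-supported {m} {u} {v} t<m
      ... | inj₁ e          = inj₁ e
      ... | inj₂ (inj₂ e)   = inj₂ e
      ... | inj₂ (inj₁ e)   = Sum.map (trans e) (trans e) p≡0̂∨q
      support : p ≡ 0̂ ⊎ p ≡ q ⊎ p ⋖ q → T (supportAtMostOne w ∨ supportCoverPair w)
      support (inj₁ p≡0̂)        = T-∨⁺ˡ {supportAtMostOne w} (supportAtMostOne⇐ w q (only-q (inj₁ p≡0̂)))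
      support (inj₂ (inj₁ p≡q)) = T-∨⁺ˡ {supportAtMostOne w} (supportAtMostOne⇐ w q (only-q (inj₂ p≡q)))
      support (inj₂ (inj₂ p⋖q)) with v ≤? u | m ≤? v
      ... | yes v≤u | _ = T-∨⁺ˡ {supportAtMostOne w} (supportAtMostOne⇐ w q λ t t<m → case₁ t t<m (region u v t))
        where
        case₁ : ∀ t → t < m → Region u v t → w ! t ≡ 0̂ ⊎ w ! t ≡ q
        case₁ t t<m (low t<u)      = inj₁ (stairs-low m u v t<m t<u)
        case₁ t t<m (mid u≤t t<v)  = ⊥-elim (n≮n _ (<-≤-trans t<v (≤-trans v≤u u≤t)))
        case₁ t t<m (high u≤t v≤t) = inj₂ (stairs-high m u v t<m u≤t v≤t)
      ... | no _ | yes m≤v = T-∨⁺ˡ {supportAtMostOne w} (supportAtMostOne⇐ w p λ t t<m → case₂ t t<m (region u v t))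
        where
        case₂ : ∀ t → t < m → Region u v t → w ! t ≡ 0̂ ⊎ w ! t ≡ p
        case₂ t t<m (low t<u)      = inj₁ (stairs-low m u v t<m t<u)
        case₂ t t<m (mid u≤t t<v)  = inj₂ (stairs-mid m u v t<m u≤t t<v)
        case₂ t t<m (high u≤t v≤t) = ⊥-elim (n≮n _ (<-≤-trans t<m (≤-trans m≤v v≤t)))
      ... | no v≰u | no m≰v = T-∨⁺ʳ {supportAtMostOne w}
        (supportCoverPair⇐ w p⋖q (λ t t<m → stairs-supported t<m) u v (<-trans u<v v<m)
           (stairs-mid m u v (<-trans u<v v<m) ≤-refl u<v) v<m (stairs-high m u v v<m (<⇒≤ u<v) ≤-refl))
        where
        u<v : u < v
        u<v = ≰⇒> v≰u
        v<m : v < m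
        v<m = ≰⇒> m≰v

    stairs⊑ᵥ : ∀ {m} (y : Vec A m) → Monotone y → ∀ u v →
               (u < v → u < m → p ⊑ y ! u) → (v < m → q ⊑ y ! v) → stairs m u v p q ⊑ᵥ y
    stairs⊑ᵥ {m} y y↑ u v p⊑yu q⊑yv t t<m with region u v t
    ... | low t<u      = subst (_⊑ y ! t) (sym (stairs-low m u v t<m t<u)) (0̂-least _)
    ... | mid u≤t t<v  = subst (_⊑ y ! t) (sym (stairs-mid m u v t<m u≤t t<v))
                           (⊑-trans (p⊑yu (≤-<-trans u≤t t<v) (≤-<-trans u≤t t<m)) (y↑ u t u≤t t<m))
    ... | high u≤t v≤t = subst (_⊑ y ! t) (sym (stairs-high m u v t<m u≤t v≤t))
                           (⊑-trans (q⊑yv (≤-<-trans v≤t t<m)) (y↑ v t v≤t t<m))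

    ⊑ᵥstairs : ∀ {m} (y : Vec A (suc m)) → Monotone y → ∀ u v → v ≤ suc m →
               (∀ {t} → t < u → y ! t ≡ 0̂) → (∀ {v'} → v ≡ suc v' → u < v → y ! v' ⊑ p) →
               y ! m ⊑ q → y ⊑ᵥ stairs (suc m) u v p q
    ⊑ᵥstairs {m} y y↑ u v v≤1+m y<u≡0̂ y<v⊑p ym⊑q t t<1+m with region u v t
    ... | low t<u      = subst (y ! t ⊑_) (sym (stairs-low (suc m) u v t<1+m t<u)) (⊑-reflexive (y<u≡0̂ t<u))
    ... | mid u≤t t<v  = subst (y ! t ⊑_) (sym (stairs-mid (suc m) u v t<1+m u≤t t<v)) (below-v v t<v v≤1+m refl)
      where
      below-v : ∀ v' → t < v' → v' ≤ suc m → v' ≡ v → y ! t ⊑ p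
      below-v (suc v') (s≤s t≤v') (s≤s v'≤m) v≡ =
        ⊑-trans (y↑ t v' t≤v' (s≤s v'≤m)) (y<v⊑p (sym v≡) (≤-<-trans u≤t t<v))
    ... | high u≤t v≤t = subst (y ! t ⊑_) (sym (stairs-high (suc m) u v t<1+m u≤t v≤t)) (⊑-trans (y↑ t m (≤-pred t<1+m) ≤-refl) ym⊑q)

  _≟ᵥ_ : ∀ {m} (a b : Vec A m) → Dec (a ≡ b)
  a ≟ᵥ b = map′ (to (eqV⇔≡ a b)) (from (eqV⇔≡ a b)) (T? (eqV a b))

  tuples-complete : ∀ {m} (v : Vec A m) → v ∈ tuples m
  tuples-complete []      = here refl
  tuples-complete (a ∷ w) = ∈-concatMap⁺ (λ a → map (a ∷_) (tuples _)) (lose (∈-elems a) (∈-map⁺ (a ∷_) (tuples-complete w)))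

  tuples-unique : ∀ m → Unique (tuples m)
  tuples-unique zero    = [] ∷ []
  tuples-unique (suc m) =
    concatMap-unique (λ a → map (a ∷_) (tuples m)) elems-unique (λ _ → map⁺ (λ { refl → refl }) (tuples-unique m)) same-head
    where
    same-head : ∀ {a a' z} → z ∈ map (a ∷_) (tuples m) → z ∈ map (a' ∷_) (tuples m) → a ≡ a'
    same-head z∈ z∈' with ∈-map⁻ _ z∈ | ∈-map⁻ _ z∈'
    ... | _ , _ , refl | _ , _ , refl = refl

  ∈coverPoset⇔InQ : ∀ {m} {v : Vec A m} → v ∈ coverPoset m ⇔ InQ v
  ∈coverPoset⇔InQ {m} {v} = mk⇔ (proj₂ ∘ ∈-filter⁻ (T? ∘ inCoverPoset) {xs = tuples m})
                                (∈-filter⁺ (T? ∘ inCoverPoset) (tuples-complete v))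

  coverPoset-unique : ∀ m → Unique (coverPoset m)
  coverPoset-unique m = filter⁺ (T? ∘ inCoverPoset) (tuples-unique m)

  covQ⇔ : ∀ {m} (x y : Vec A m) → T (covQ m x y) ⇔ (x ⊏ᵥ y × (∀ z → InQ z → x ⊏ᵥ z → ¬ z ⊏ᵥ y))
  covQ⇔ {m} x y = mk⇔ sound complete
    where
    between : Vec A m → Bool
    between z = ltV x z ∧ ltV z y
    sound : T (covQ m x y) → x ⊏ᵥ y × (∀ z → InQ z → x ⊏ᵥ z → ¬ z ⊏ᵥ y)
    sound h = let x<y , none = T-∧⁻ {ltV x y} h in
      to (ltV⇔⊏ᵥ x y) x<y , λ z z∈Q x⊏z z⊏y →
        T-not⁻ none (any⁺ between (lose (from ∈coverPoset⇔InQ z∈Q)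
          (T-∧⁺ (from (ltV⇔⊏ᵥ x z) x⊏z) (from (ltV⇔⊏ᵥ z y) z⊏y))))
    complete : x ⊏ᵥ y × (∀ z → InQ z → x ⊏ᵥ z → ¬ z ⊏ᵥ y) → T (covQ m x y)
    complete (x⊏y , none) = T-∧⁺ (from (ltV⇔⊏ᵥ x y) x⊏y) (T-not⁺ λ h →
      let z , z∈ , hz = find (any⁻ between (coverPoset m) h)
          x<z , z<y = T-∧⁻ {ltV x z} hz
      in none z (to ∈coverPoset⇔InQ z∈) (to (ltV⇔⊏ᵥ x z) x<z) (to (ltV⇔⊏ᵥ z y) z<y))

  -- The minimal elements of Q strictly above x are exactly its upper covers.
  record MinimalAbove {m} (x : Vec A m) (cs : List (Vec A m)) : Set where
    field
      unique    : Unique cs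
      above     : ∀ {c} → c ∈ cs → InQ c × x ⊏ᵥ c
      antichain : ∀ {c c'} → c ∈ cs → c' ∈ cs → c' ⊑ᵥ c → c' ≡ c
      dominated : ∀ y → InQ y → x ⊏ᵥ y → ∃[ c ] c ∈ cs × c ⊑ᵥ y

  record MaximalBelow {m} (x : Vec A m) (cs : List (Vec A m)) : Set where
    field
      unique     : Unique cs
      below      : ∀ {c} → c ∈ cs → InQ c × c ⊏ᵥ x
      antichain  : ∀ {c c'} → c ∈ cs → c' ∈ cs → c ⊑ᵥ c' → c ≡ c'
      dominating : ∀ y → InQ y → y ⊏ᵥ x → ∃[ c ] c ∈ cs × y ⊑ᵥ c

  module _ {m} {x : Vec A m} where

    minimalAbove-[] : (∀ y → InQ y → ¬ x ⊏ᵥ y) → MinimalAbove x []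
    minimalAbove-[] maximal = record
      { unique = [] ; above = λ () ; antichain = λ () ; dominated = λ y y∈Q x⊏y → ⊥-elim (maximal y y∈Q x⊏y) }

    minimalAbove-[_] : ∀ {c} → InQ c × x ⊏ᵥ c → (∀ y → InQ y → x ⊏ᵥ y → c ⊑ᵥ y) → MinimalAbove x (c ∷ [])
    minimalAbove-[ c-above ] least = record
      { unique    = [] ∷ []
      ; above     = λ { (here refl) → c-above }
      ; antichain = λ { (here refl) (here refl) _ → refl }
      ; dominated = λ y y∈Q x⊏y → _ , here refl , least y y∈Q x⊏y
      }

    minimalAbove-pair : ∀ {c₁ c₂} → InQ c₁ × x ⊏ᵥ c₁ → InQ c₂ × x ⊏ᵥ c₂ → ¬ c₁ ⊑ᵥ c₂ → ¬ c₂ ⊑ᵥ c₁ →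
                        (∀ y → InQ y → x ⊏ᵥ y → c₁ ⊑ᵥ y ⊎ c₂ ⊑ᵥ y) → MinimalAbove x (c₁ ∷ c₂ ∷ [])
    minimalAbove-pair {c₁} {c₂} c₁-above c₂-above c₁⋢c₂ c₂⋢c₁ dominated = record
      { unique    = ((λ { refl → c₁⋢c₂ (⊑ᵥ-refl c₁) }) ∷ []) ∷ [] ∷ []
      ; above     = λ { (here refl) → c₁-above ; (there (here refl)) → c₂-above }
      ; antichain = λ { (here refl) (here refl) _ → refl
                      ; (there (here refl)) (there (here refl)) _ → refl
                      ; (here refl) (there (here refl)) c₂⊑c₁ → ⊥-elim (c₂⋢c₁ c₂⊑c₁)
                      ; (there (here refl)) (here refl) c₁⊑c₂ → ⊥-elim (c₁⋢c₂ c₁⊑c₂) }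
      ; dominated = λ y y∈Q x⊏y → [ (λ c₁⊑y → c₁ , here refl , c₁⊑y) , (λ c₂⊑y → c₂ , there (here refl) , c₂⊑y) ]′
                                    (dominated y y∈Q x⊏y)
      }

    minimalAbove-image : ∀ {B : Set} (f : B → Vec A m) {bs} → Unique bs → (∀ {b} → b ∈ bs → InQ (f b) × x ⊏ᵥ f b) →
                         (∀ {b b'} → b ∈ bs → b' ∈ bs → f b' ⊑ᵥ f b → b' ≡ b) →
                         (∀ y → InQ y → x ⊏ᵥ y → ∃[ b ] b ∈ bs × f b ⊑ᵥ y) → MinimalAbove x (map f bs)
    minimalAbove-image f bs! above antichain dominated = record
      { unique    = map-unique f bs! (λ {b} b∈ b'∈ fb≡fb' → sym (antichain b∈ b'∈ (subst (_⊑ᵥ f b) fb≡fb' (⊑ᵥ-refl (f b)))))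
      ; above     = λ c∈ → let b , b∈ , c≡ = ∈-map⁻ f c∈ in subst (λ c → InQ c × x ⊏ᵥ c) (sym c≡) (above b∈)
      ; antichain = λ c∈ c'∈ c'⊑c → let b , b∈ , c≡ = ∈-map⁻ f c∈ ; b' , b'∈ , c'≡ = ∈-map⁻ f c'∈ in
                      trans c'≡ (trans (cong f (antichain b∈ b'∈ (subst₂ _⊑ᵥ_ c'≡ c≡ c'⊑c))) (sym c≡))
      ; dominated = λ y y∈Q x⊏y → let b , b∈ , fb⊑y = dominated y y∈Q x⊏y in f b , ∈-map⁺ f b∈ , fb⊑y
      }

    maximalBelow-[] : (∀ y → InQ y → ¬ y ⊏ᵥ x) → MaximalBelow x []
    maximalBelow-[] minimal = record
      { unique = [] ; below = λ () ; antichain = λ () ; dominating = λ y y∈Q y⊏x → ⊥-elim (minimal y y∈Q y⊏x) }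

    maximalBelow-[_] : ∀ {c} → InQ c × c ⊏ᵥ x → (∀ y → InQ y → y ⊏ᵥ x → y ⊑ᵥ c) → MaximalBelow x (c ∷ [])
    maximalBelow-[ c-below ] greatest = record
      { unique     = [] ∷ []
      ; below      = λ { (here refl) → c-below }
      ; antichain  = λ { (here refl) (here refl) _ → refl }
      ; dominating = λ y y∈Q y⊏x → _ , here refl , greatest y y∈Q y⊏x
      }

    maximalBelow-pair : ∀ {c₁ c₂} → InQ c₁ × c₁ ⊏ᵥ x → InQ c₂ × c₂ ⊏ᵥ x → ¬ c₁ ⊑ᵥ c₂ → ¬ c₂ ⊑ᵥ c₁ →
                        (∀ y → InQ y → y ⊏ᵥ x → y ⊑ᵥ c₁ ⊎ y ⊑ᵥ c₂) → MaximalBelow x (c₁ ∷ c₂ ∷ [])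
    maximalBelow-pair {c₁} {c₂} c₁-below c₂-below c₁⋢c₂ c₂⋢c₁ dominating = record
      { unique     = ((λ { refl → c₁⋢c₂ (⊑ᵥ-refl c₁) }) ∷ []) ∷ [] ∷ []
      ; below      = λ { (here refl) → c₁-below ; (there (here refl)) → c₂-below }
      ; antichain  = λ { (here refl) (here refl) _ → refl
                       ; (there (here refl)) (there (here refl)) _ → refl
                       ; (here refl) (there (here refl)) c₁⊑c₂ → ⊥-elim (c₁⋢c₂ c₁⊑c₂)
                       ; (there (here refl)) (here refl) c₂⊑c₁ → ⊥-elim (c₂⋢c₁ c₂⊑c₁) }
      ; dominating = λ y y∈Q y⊏x → [ (λ y⊑c₁ → c₁ , here refl , y⊑c₁) , (λ y⊑c₂ → c₂ , there (here refl) , y⊑c₂) ]′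
                                     (dominating y y∈Q y⊏x)
      }

    maximalBelow-image : ∀ {B : Set} (f : B → Vec A m) {bs} → Unique bs → (∀ {b} → b ∈ bs → InQ (f b) × f b ⊏ᵥ x) →
                         (∀ {b b'} → b ∈ bs → b' ∈ bs → f b ⊑ᵥ f b' → b ≡ b') →
                         (∀ y → InQ y → y ⊏ᵥ x → ∃[ b ] b ∈ bs × y ⊑ᵥ f b) → MaximalBelow x (map f bs)
    maximalBelow-image f bs! below antichain dominating = record
      { unique     = map-unique f bs! (λ {b} b∈ b'∈ fb≡fb' → antichain b∈ b'∈ (subst (f b ⊑ᵥ_) fb≡fb' (⊑ᵥ-refl (f b))))
      ; below      = λ c∈ → let b , b∈ , c≡ = ∈-map⁻ f c∈ in subst (λ c → InQ c × c ⊏ᵥ x) (sym c≡) (below b∈)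
      ; antichain  = λ c∈ c'∈ c⊑c' → let b , b∈ , c≡ = ∈-map⁻ f c∈ ; b' , b'∈ , c'≡ = ∈-map⁻ f c'∈ in
                       trans c≡ (trans (cong f (antichain b∈ b'∈ (subst₂ _⊑ᵥ_ c≡ c'≡ c⊑c'))) (sym c'≡))
      ; dominating = λ y y∈Q y⊏x → let b , b∈ , y⊑fb = dominating y y∈Q y⊏x in f b , ∈-map⁺ f b∈ , y⊑fb
      }

  numUpperCovers≡length : ∀ {m} {x : Vec A m} {cs} → MinimalAbove x cs → numUpperCovers m x ≡ length cs
  numUpperCovers≡length {m} {x} {cs} min =
    unique∧set⇒length≡ (filter⁺ (λ y → T? (covQ m x y)) (coverPoset-unique m)) unique cover⇒listed listed⇒cover
    where
    open MinimalAbove min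
    cover⇒listed : ∀ {y} → y ∈ filter (λ y → T? (covQ m x y)) (coverPoset m) → y ∈ cs
    cover⇒listed {y} y∈ =
      let y∈Q , x⋖y = ∈-filter⁻ (λ y → T? (covQ m x y)) {xs = coverPoset m} y∈
          x⊏y , nothing-between = to (covQ⇔ x y) x⋖y
          c , c∈cs , c⊑y = dominated y (to ∈coverPoset⇔InQ y∈Q) x⊏y
      in case c ≟ᵥ y of λ where
           (yes c≡y) → subst (_∈ cs) c≡y c∈cs
           (no c≢y)  → ⊥-elim (nothing-between c (proj₁ (above c∈cs)) (proj₂ (above c∈cs)) (c⊑y , c≢y))
    listed⇒cover : ∀ {y} → y ∈ cs → y ∈ filter (λ y → T? (covQ m x y)) (coverPoset m)
    listed⇒cover {y} y∈cs = ∈-filter⁺ (λ y → T? (covQ m x y)) (from ∈coverPoset⇔InQ (proj₁ (above y∈cs)))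
      (from (covQ⇔ x y) (proj₂ (above y∈cs) , nothing-between))
      where
      nothing-between : ∀ z → InQ z → x ⊏ᵥ z → ¬ z ⊏ᵥ y
      nothing-between z z∈Q x⊏z (z⊑y , z≢y) =
        let c , c∈cs , c⊑z = dominated z z∈Q x⊏z
        in z≢y (⊑ᵥ-antisym z⊑y (subst (_⊑ᵥ z) (antichain y∈cs c∈cs (⊑ᵥ-trans {a = c} {z} {y} c⊑z z⊑y)) c⊑z))

  numLowerCovers≡length : ∀ {m} {x : Vec A m} {cs} → MaximalBelow x cs → numLowerCovers m x ≡ length cs
  numLowerCovers≡length {m} {x} {cs} max =
    unique∧set⇒length≡ (filter⁺ (λ y → T? (covQ m y x)) (coverPoset-unique m)) unique cover⇒listed listed⇒cover
    where
    open MaximalBelow max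
    cover⇒listed : ∀ {y} → y ∈ filter (λ y → T? (covQ m y x)) (coverPoset m) → y ∈ cs
    cover⇒listed {y} y∈ =
      let y∈Q , y⋖x = ∈-filter⁻ (λ y → T? (covQ m y x)) {xs = coverPoset m} y∈
          y⊏x , nothing-between = to (covQ⇔ y x) y⋖x
          c , c∈cs , y⊑c = dominating y (to ∈coverPoset⇔InQ y∈Q) y⊏x
      in case y ≟ᵥ c of λ where
           (yes y≡c) → subst (_∈ cs) (sym y≡c) c∈cs
           (no y≢c)  → ⊥-elim (nothing-between c (proj₁ (below c∈cs)) (y⊑c , y≢c) (proj₂ (below c∈cs)))
    listed⇒cover : ∀ {y} → y ∈ cs → y ∈ filter (λ y → T? (covQ m y x)) (coverPoset m)
    listed⇒cover {y} y∈cs = ∈-filter⁺ (λ y → T? (covQ m y x)) (from ∈coverPoset⇔InQ (proj₁ (below y∈cs)))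
      (from (covQ⇔ y x) (proj₂ (below y∈cs) , nothing-between))
      where
      nothing-between : ∀ z → InQ z → y ⊏ᵥ z → ¬ z ⊏ᵥ x
      nothing-between z z∈Q (y⊑z , y≢z) z⊏x =
        let c , c∈cs , z⊑c = dominating z z∈Q z⊏x
        in y≢z (⊑ᵥ-antisym y⊑z (subst (z ⊑ᵥ_) (sym (antichain y∈cs c∈cs (⊑ᵥ-trans {a = y} {z} {c} y⊑z z⊑c))) z⊑c))

  length-filter-coverPoset : ∀ {m} (L : List (Vec A m)) → Unique L → (∀ {z} → z ∈ L ⇔ InQ z) →
    (g : Vec A m → Bool) → length (filter (T? ∘ g) (coverPoset m)) ≡ ∑ (λ x → if g x then 1 else 0) L
  length-filter-coverPoset {m} L L! ∈L⇔InQ g =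
    trans (unique∧set⇒length≡ (filter⁺ (T? ∘ g) (coverPoset-unique m)) (filter⁺ (T? ∘ g) L!)
             (transfer (from ∈L⇔InQ ∘ to ∈coverPoset⇔InQ)) (transfer (from ∈coverPoset⇔InQ ∘ to ∈L⇔InQ)))
          (length-filter≡∑ g L)
    where
    transfer : ∀ {xs ys} → (∀ {z} → z ∈ xs → z ∈ ys) → ∀ {z} → z ∈ filter (T? ∘ g) xs → z ∈ filter (T? ∘ g) ys
    transfer {xs} xs⊆ys z∈ = let z∈xs , gz = ∈-filter⁻ (T? ∘ g) {xs = xs} z∈ in ∈-filter⁺ (T? ∘ g) (xs⊆ys z∈xs) gz

-- The poset P_{k,l}

does-≟ᶠ-refl : ∀ {n} (i : Fin n) → T (does (i ≟ᶠ i))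
does-≟ᶠ-refl i with i ≟ᶠ i
... | yes _   = tt
... | no i≢i  = i≢i refl

module _ {k l : ℕ} where

  infix 4 _≼_

  data _≼_ : Pkl k l → Pkl k l → Set where
    bot≼  : ∀ {x} → bot ≼ x
    ≼top  : ∀ {x} → x ≼ top
    ch≼ch : ∀ {i j} → toℕ i ≤ toℕ j → ch i ≼ ch j
    an≼an : ∀ {i} → an i ≼ an i

  ≼-refl : ∀ {x} → x ≼ x
  ≼-refl {bot}  = bot≼
  ≼-refl {top}  = ≼top
  ≼-refl {ch i} = ch≼ch ≤-refl
  ≼-refl {an i} = an≼an

  ≼-trans : ∀ {x y z} → x ≼ y → y ≼ z → x ≼ z
  ≼-trans bot≼       _          = bot≼
  ≼-trans _          ≼top       = ≼top
  ≼-trans (ch≼ch i≤j) (ch≼ch j≤k) = ch≼ch (≤-trans i≤j j≤k)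
  ≼-trans an≼an      an≼an      = an≼an

  ≼-antisym : ∀ {x y} → x ≼ y → y ≼ x → x ≡ y
  ≼-antisym bot≼        bot≼        = refl
  ≼-antisym ≼top        ≼top        = refl
  ≼-antisym (ch≼ch i≤j) (ch≼ch j≤i) = cong ch (toℕ-injective (≤-antisym i≤j j≤i))
  ≼-antisym an≼an       an≼an       = refl

  ≼-isPartialOrder : IsPartialOrder _≡_ _≼_
  ≼-isPartialOrder = record
    { isPreorder = record { isEquivalence = isEquivalence ; reflexive = λ { refl → ≼-refl } ; trans = ≼-trans }
    ; antisym    = ≼-antisym
    }

  leqPkl⇔≼ : ∀ {x y} → T (leqPkl x y) ⇔ x ≼ y
  leqPkl⇔≼ = mk⇔ (sound _ _) complete
    where
    sound : ∀ x y → T (leqPkl x y) → x ≼ y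
    sound bot    _      _ = bot≼
    sound top    top    _ = ≼top
    sound (ch _) top    _ = ≼top
    sound (an _) top    _ = ≼top
    sound (ch i) (ch j) h = ch≼ch (≤ᵇ⇒≤ (toℕ i) (toℕ j) h)
    sound (an i) (an j) h with i ≟ᶠ j
    ... | yes refl = an≼an
    sound top    bot    ()
    sound top    (ch _) ()
    sound top    (an _) ()
    sound (ch _) bot    ()
    sound (ch _) (an _) ()
    sound (an _) bot    ()
    sound (an _) (ch _) ()
    complete : ∀ {x y} → x ≼ y → T (leqPkl x y)
    complete bot≼            = tt
    complete (≼top {bot})    = tt
    complete (≼top {top})    = tt
    complete (≼top {ch _})   = tt
    complete (≼top {an _})   = tt
    complete (ch≼ch i≤j)     = ≤⇒≤ᵇ i≤j
    complete (an≼an {i})     = does-≟ᶠ-refl i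

  eqPkl⇔≡ : ∀ {x y : Pkl k l} → T (eqPkl x y) ⇔ x ≡ y
  eqPkl⇔≡ {x} = mk⇔ (sound _ _) λ { refl → reflexive x }
    where
    sound : ∀ x y → T (eqPkl x y) → x ≡ y
    sound bot    bot    _ = refl
    sound top    top    _ = refl
    sound (ch i) (ch j) h with i ≟ᶠ j
    ... | yes refl = refl
    sound (an i) (an j) h with i ≟ᶠ j
    ... | yes refl = refl
    sound bot    top    ()
    sound bot    (ch _) ()
    sound bot    (an _) ()
    sound top    bot    ()
    sound top    (ch _) ()
    sound top    (an _) ()
    sound (ch _) bot    ()
    sound (ch _) top    ()
    sound (ch _) (an _) ()
    sound (an _) bot    ()
    sound (an _) top    ()
    sound (an _) (ch _) ()
    reflexive : ∀ x → T (eqPkl x x)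
    reflexive bot    = tt
    reflexive top    = tt
    reflexive (ch i) = does-≟ᶠ-refl i
    reflexive (an i) = does-≟ᶠ-refl i

  ∈-allPkl : ∀ x → x ∈ allPkl {k} {l}
  ∈-allPkl bot    = here refl
  ∈-allPkl top    = there (here refl)
  ∈-allPkl (ch i) = there (there (∈-++⁺ˡ (∈-map⁺ ch (∈-allFin i))))
  ∈-allPkl (an i) = there (there (∈-++⁺ʳ (map ch (allFin k)) (∈-map⁺ an (∈-allFin i))))

  allPkl-unique : Unique (allPkl {k} {l})
  allPkl-unique =
    All.tabulate (λ x∈ → bot∉ x∈) ∷ All.tabulate (λ x∈ → top∉ x∈)
      ∷ ++⁺ (map⁺ (λ { refl → refl }) (allFin⁺ k)) (map⁺ (λ { refl → refl }) (allFin⁺ l)) ch∉an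
    where
    proper : List (Pkl k l)
    proper = map ch (allFin k) ++ map an (allFin l)
    ∈proper : ∀ {x} → x ∈ proper → (∃[ i ] x ≡ ch i) ⊎ (∃[ j ] x ≡ an j)
    ∈proper x∈ with ∈-++⁻ (map ch (allFin k)) x∈
    ... | inj₁ x∈ch = let i , _ , x≡ = ∈-map⁻ ch x∈ch in inj₁ (i , x≡)
    ... | inj₂ x∈an = let j , _ , x≡ = ∈-map⁻ an x∈an in inj₂ (j , x≡)
    top∉ : ∀ {x} → x ∈ proper → top ≢ x
    top∉ x∈ top≡x with ∈proper x∈
    ... | inj₁ (_ , refl) = case top≡x of λ ()
    ... | inj₂ (_ , refl) = case top≡x of λ ()
    bot∉ : ∀ {x} → x ∈ top ∷ proper → bot ≢ x
    bot∉ (here refl) ()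
    bot∉ (there x∈) bot≡x with ∈proper x∈
    ... | inj₁ (_ , refl) = case bot≡x of λ ()
    ... | inj₂ (_ , refl) = case bot≡x of λ ()
    ch∉an : ∀ {x} → x ∈ map ch (allFin k) × x ∈ map an (allFin l) → ⊥
    ch∉an (x∈ch , x∈an) with ∈-map⁻ ch x∈ch | ∈-map⁻ an x∈an
    ... | _ , _ , refl | _ , _ , ()

module Cover (k l : ℕ) =
  CoverPoset (allPkl {k} {l}) leqPkl eqPkl bot ≼-isPartialOrder leqPkl⇔≼ eqPkl⇔≡ (λ _ → bot≼) ∈-allPkl allPkl-unique

ch-injective : ∀ {k l} {i j : Fin k} → ch {k} {l} i ≡ ch j → i ≡ j
ch-injective refl = refl

Proper : ℕ → ℕ → Set
Proper k l = Fin k ⊎ Fin l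

module _ {k l : ℕ} where
  open Cover k l

  elem : Proper k l → Pkl k l
  elem (inj₁ i) = ch i
  elem (inj₂ j) = an j

  elem≢bot : ∀ p → elem p ≢ bot
  elem≢bot (inj₁ _) ()
  elem≢bot (inj₂ _) ()

  elem≢top : ∀ p → elem p ≢ top
  elem≢top (inj₁ _) ()
  elem≢top (inj₂ _) ()

  elem-injective : ∀ {p q} → elem p ≡ elem q → p ≡ q
  elem-injective {inj₁ _} {inj₁ _} refl = refl
  elem-injective {inj₂ _} {inj₂ _} refl = refl

  proper-view : ∀ s → s ≢ bot → s ≢ top → ∃[ p ] s ≡ elem p
  proper-view bot    s≢bot _     = ⊥-elim (s≢bot refl)
  proper-view top    _     s≢top = ⊥-elim (s≢top refl)
  proper-view (ch i) _     _     = inj₁ i , refl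
  proper-view (an j) _     _     = inj₂ j , refl

  ch⊏ch⇒< : ∀ {i j} → ch i ⊏ ch j → toℕ i < toℕ j
  ch⊏ch⇒< (ch≼ch i≤j , ch-i≢ch-j) = ≤∧≢⇒< i≤j (ch-i≢ch-j ∘ cong ch ∘ toℕ-injective)

  up : Proper k l → Pkl k l
  up (inj₁ i) with suc (toℕ i) <? k
  ... | yes i+1<k = ch (fromℕ< i+1<k)
  ... | no _      = top
  up (inj₂ _) = top

  elem⊏up : ∀ p → elem p ⊏ up p
  elem⊏up (inj₂ _) = ≼top , λ ()
  elem⊏up (inj₁ i) with suc (toℕ i) <? k
  ... | yes i+1<k = ch≼ch (subst (toℕ i ≤_) (sym (toℕ-fromℕ< i+1<k)) (n≤1+n _)) ,
                    λ i≡i+1 → 1+n≢n (sym (trans (cong toℕ (ch-injective i≡i+1)) (toℕ-fromℕ< i+1<k)))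
  ... | no _      = ≼top , λ ()

  up-least : ∀ p {s} → elem p ⊏ s → up p ≼ s
  up-least (inj₂ _) {top}  _                = ≼top
  up-least (inj₂ _) {an _} (an≼an , a≢a)    = ⊥-elim (a≢a refl)
  up-least (inj₁ i) {top}  _                = ≼top
  up-least (inj₁ i) {ch j} i⊏j with suc (toℕ i) <? k
  ... | yes i+1<k = ch≼ch (subst (_≤ toℕ j) (sym (toℕ-fromℕ< i+1<k)) (ch⊏ch⇒< i⊏j))
  ... | no i+1≮k  = ⊥-elim (i+1≮k (≤-<-trans (ch⊏ch⇒< i⊏j) (toℕ<n j)))

  up-⋖ : ∀ p → elem p ⋖ up p
  up-⋖ p = ⊏-least⇒⋖ (elem⊏up p) (up-least p)

  ⋖⇒≡up : ∀ p {w} → elem p ⋖ w → w ≡ up p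
  ⋖⇒≡up p p⋖w = sym (⋖-above p⋖w (elem⊏up p) (up-least p (proj₁ p⋖w)))

  down : Proper k l → Pkl k l
  down (inj₁ fzero)    = bot
  down (inj₁ (fsuc i)) = ch (inject₁ i)
  down (inj₂ _)        = bot

  down⊏elem : ∀ p → down p ⊏ elem p
  down⊏elem (inj₂ _)        = bot≼ , λ ()
  down⊏elem (inj₁ fzero)    = bot≼ , λ ()
  down⊏elem (inj₁ (fsuc i)) = ch≼ch (subst (_≤ suc (toℕ i)) (sym (toℕ-inject₁ i)) (n≤1+n _)) ,
                              λ i≡i+1 → 1+n≢n (sym (trans (sym (toℕ-inject₁ i)) (cong toℕ (ch-injective i≡i+1))))

  down-greatest : ∀ p {s} → s ⊏ elem p → s ≼ down p
  down-greatest (inj₂ _)        {bot}  _             = bot≼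
  down-greatest (inj₂ _)        {an _} (an≼an , a≢a) = ⊥-elim (a≢a refl)
  down-greatest (inj₁ fzero)    {bot}  _             = bot≼
  down-greatest (inj₁ fzero)    {ch j} j⊏0           = ⊥-elim (n≮n 0 (≤-<-trans z≤n (ch⊏ch⇒< j⊏0)))
  down-greatest (inj₁ (fsuc i)) {bot}  _             = bot≼
  down-greatest (inj₁ (fsuc i)) {ch j} j⊏i+1         =
    ch≼ch (subst (toℕ j ≤_) (sym (toℕ-inject₁ i)) (≤-pred (ch⊏ch⇒< j⊏i+1)))

  down-⋖ : ∀ p → down p ⋖ elem p
  down-⋖ p = ⊏-greatest⇒⋖ (down⊏elem p) (down-greatest p)

  ⋖⇒≡down : ∀ p {s} → s ⋖ elem p → s ≡ down p
  ⋖⇒≡down p s⋖p = sym (⋖-below s⋖p (down-greatest p (proj₁ s⋖p)) (down⊏elem p))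

  -- s is proper, so w is its unique upper cover, which lies below everything strictly above s.
  ⋖⇒≼-above : ∀ p {s w} → s ≢ bot → s ⊏ elem p → s ⋖ w → w ≼ elem p
  ⋖⇒≼-above p {s} s≢bot (s≼p , s≢p) s⋖w
    with proper-view s s≢bot (λ { refl → elem≢top p (≼-antisym ≼top s≼p) })
  ... | q , refl = subst (_≼ elem p) (sym (⋖⇒≡up q s⋖w)) (up-least q (s≼p , s≢p))

  -- The lower cover of p, or p itself when p is an atom.
  lower : Proper k l → Pkl k l
  lower (inj₁ fzero)    = ch fzero
  lower (inj₁ (fsuc i)) = ch (inject₁ i)
  lower (inj₂ j)        = an j

  lower≢bot : ∀ p → lower p ≢ bot
  lower≢bot (inj₁ fzero)    ()
  lower≢bot (inj₁ (fsuc _)) ()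
  lower≢bot (inj₂ _)        ()

  lower-cases : ∀ p → lower p ≡ elem p ⊎ lower p ⋖ elem p
  lower-cases (inj₁ fzero)    = inj₁ refl
  lower-cases (inj₁ (fsuc i)) = inj₂ (down-⋖ (inj₁ (fsuc i)))
  lower-cases (inj₂ _)        = inj₁ refl

  lower≼elem : ∀ p → lower p ≼ elem p
  lower≼elem p = [ (λ e → subst (_≼ elem p) (sym e) ≼-refl) , proj₁ ∘ proj₁ ]′ (lower-cases p)

  lower≡down : ∀ p → down p ≢ bot → lower p ≡ down p
  lower≡down (inj₁ fzero)    d≢bot = ⊥-elim (d≢bot refl)
  lower≡down (inj₁ (fsuc _)) _     = refl
  lower≡down (inj₂ _)        d≢bot = ⊥-elim (d≢bot refl)

  data Shape : Set where
    zeros : Shape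
    tops  : ℕ → Shape
    flat  : Proper k l → ℕ → Shape
    rise  : Proper k l → ℕ → ℕ → Shape

  Valid : ℕ → Shape → Set
  Valid m zeros        = ⊤
  Valid m (tops u)     = u < m
  Valid m (flat _ u)   = u < m
  Valid m (rise _ u v) = u < v × v < m

  shape : (m : ℕ) → Shape → Vec (Pkl k l) m
  shape m zeros        = stairs m m m bot bot
  shape m (tops u)     = stairs m u u bot top
  shape m (flat p u)   = stairs m u u bot (elem p)
  shape m (rise p u v) = stairs m u v (elem p) (up p)

  shape∈Q : ∀ m π → InQ (shape m π)
  shape∈Q m zeros        = stairs∈Q m m m (inj₁ refl)
  shape∈Q m (tops u)     = stairs∈Q m u u (inj₁ refl)
  shape∈Q m (flat p u)   = stairs∈Q m u u (inj₁ refl)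
  shape∈Q m (rise p u v) = stairs∈Q m u v (inj₂ (inj₂ (up-⋖ p)))

  zeros-least : ∀ {m} (y : Vec (Pkl k l) m) → shape m zeros ⊑ᵥ y
  zeros-least {m} y t t<m = subst (_≼ y ! t) (sym (stairs-low m m m t<m t<m)) bot≼

  tops-greatest : ∀ {m} (y : Vec (Pkl k l) m) → y ⊑ᵥ shape m (tops 0)
  tops-greatest {m} y t t<m = subst (y ! t ≼_) (sym (stairs-high m 0 0 t<m z≤n z≤n)) ≼top

  -- Every element of P_{k,l}^⟨m⟩ is a staircase of exactly one valid shape

  private
    Chain : ∀ {m} → Vec (Pkl k l) m → Set
    Chain v = Monotone v × StepsAreCovers v

    Chain-tail : ∀ {m} {a} {w : Vec (Pkl k l) m} → Chain (a ∷ w) → Chain w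
    Chain-tail (a∷w↑ , a∷w-covers) = (λ s t s≤t t<m → a∷w↑ (suc s) (suc t) (s≤s s≤t) (s≤s t<m)) ,
                                     (λ s t s≤t t<m → a∷w-covers (suc s) (suc t) (s≤s s≤t) (s≤s t<m))

    head⋖ : ∀ {m a} {w : Vec (Pkl k l) (suc m)} → Chain (a ∷ w) → a ≢ bot → a ≢ w ! 0 → a ⋖ w ! 0
    head⋖ (_ , covers) a≢bot a≢w₀ = covers 0 1 z≤n (s≤s (s≤s z≤n)) a≢bot a≢w₀

    head≼ : ∀ {m a} {w : Vec (Pkl k l) (suc m)} → Chain (a ∷ w) → a ≼ w ! 0
    head≼ (a∷w↑ , _) = a∷w↑ 0 1 z≤n (s≤s (s≤s z≤n))

    stairs-flat : ∀ m {p p' q : Pkl k l} → stairs m 0 0 p q ≡ stairs m 0 0 p' q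
    stairs-flat zero    = refl
    stairs-flat (suc m) = cong (_ ∷_) (stairs-flat m)

    Classified : ∀ m → Vec (Pkl k l) m → Set
    Classified m v = ∃[ π ] Valid m π × v ≡ shape m π

    extend : ∀ m a π → Valid m π → Chain (a ∷ shape m π) → a ≢ bot → Classified (suc m) (a ∷ shape m π)
    extend zero a zeros _ _ a≢bot with a ≟ top
    ... | yes refl = tops 0 , s≤s z≤n , refl
    ... | no a≢top with proper-view a a≢bot a≢top
    ...   | p , refl = flat p 0 , s≤s z≤n , refl
    extend (suc m) a zeros            _ chain a≢bot = ⊥-elim (a≢bot (⊑0̂⇒≡0̂ (head≼ chain)))
    extend (suc m) a (tops (suc _))   _ chain a≢bot = ⊥-elim (a≢bot (⊑0̂⇒≡0̂ (head≼ chain)))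
    extend (suc m) a (flat _ (suc _)) _ chain a≢bot = ⊥-elim (a≢bot (⊑0̂⇒≡0̂ (head≼ chain)))
    extend (suc m) a (rise _ (suc _) _) _ chain a≢bot = ⊥-elim (a≢bot (⊑0̂⇒≡0̂ (head≼ chain)))
    extend (suc m) a (tops 0) _ chain a≢bot with a ≟ top
    ... | yes refl = tops 0 , s≤s z≤n , refl
    ... | no a≢top with proper-view a a≢bot a≢top
    ...   | p , refl = rise p 0 1 , (s≤s z≤n , s≤s (s≤s z≤n)) ,
                       cong (elem p ∷_) (cong₂ _∷_ top≡up (trans (stairs-flat m) (cong (stairs m 0 0 (elem p)) top≡up)))
      where
      top≡up : top ≡ up p
      top≡up = ⋖⇒≡up p (head⋖ chain a≢bot a≢top)
    extend (suc m) a (flat p 0) _ chain a≢bot with a ≟ elem p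
    ... | yes refl = flat p 0 , s≤s z≤n , refl
    ... | no a≢p with proper-view a a≢bot (λ { refl → elem≢top p (≼-antisym ≼top (head≼ chain)) })
    ...   | p' , refl = rise p' 0 1 , (s≤s z≤n , s≤s (s≤s z≤n)) ,
                        cong (elem p' ∷_) (cong₂ _∷_ p≡up (trans (stairs-flat m) (cong (stairs m 0 0 (elem p')) p≡up)))
      where
      p≡up : elem p ≡ up p'
      p≡up = ⋖⇒≡up p' (head⋖ chain a≢bot a≢p)
    extend (suc m) a (rise p 0 (suc v)) (_ , v<m) chain a≢bot with a ≟ elem p
    ... | yes refl = rise p 0 (suc (suc v)) , (s≤s z≤n , s≤s v<m) , refl
    ... | no a≢p   = ⊥-elim (proj₂ (elem⊏up p) (⋖-above a⋖up (proj₁ a⋖p) (proj₁ (elem⊏up p))))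
      where
      -- a would be covered both by p and by its upper cover.
      w : Vec (Pkl k l) (suc m)
      w = shape (suc m) (rise p 0 (suc v))
      w-last≡up : w ! m ≡ up p
      w-last≡up = stairs-high (suc m) 0 (suc v) ≤-refl z≤n (≤-pred v<m)
      a⋖p : a ⋖ elem p
      a⋖p = head⋖ chain a≢bot a≢p
      a⋖up : a ⋖ up p
      a⋖up = subst (a ⋖_) w-last≡up (proj₂ chain 0 (suc m) z≤n (s≤s ≤-refl) a≢bot
        (λ a≡ → proj₂ (elem⊏up p) (≼-antisym (proj₁ (elem⊏up p)) (subst (_≼ elem p) (trans a≡ w-last≡up) (proj₁ (proj₁ a⋖p))))))

  classify : ∀ m (v : Vec (Pkl k l) m) → InQ v → ∃[ π ] Valid m π × v ≡ shape m π
  classify m v v∈Q = go m v (InQ⇒monotone v v∈Q , InQ⇒stepsAreCovers v v∈Q)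
    where
    shift : ∀ {m} π → Valid m π → Classified (suc m) (bot ∷ shape m π)
    shift zeros        _           = zeros , tt , refl
    shift (tops u)     u<m         = tops (suc u) , s≤s u<m , refl
    shift (flat p u)   u<m         = flat p (suc u) , s≤s u<m , refl
    shift (rise p u v) (u<v , v<m) = rise p (suc u) (suc v) , (s≤s u<v , s≤s v<m) , refl
    go : ∀ m (v : Vec (Pkl k l) m) → Chain v → Classified m v
    go zero    []      _  = zeros , tt , refl
    go (suc m) (a ∷ w) chain with go m w (Chain-tail chain) | a ≟ bot
    ... | π , π-valid , refl | yes refl  = shift π π-valid
    ... | π , π-valid , refl | no a≢bot  = extend m a π π-valid chain a≢bot

  private
    first : ℕ → Shape → ℕ
    first m zeros        = m
    first _ (tops u)     = u
    first _ (flat _ u)   = u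
    first _ (rise _ u _) = u

    leading : Shape → Pkl k l
    leading zeros        = bot
    leading (tops _)     = top
    leading (flat p _)   = elem p
    leading (rise p _ _) = elem p

    final : Shape → Pkl k l
    final zeros        = bot
    final (tops _)     = top
    final (flat p _)   = elem p
    final (rise p _ _) = up p

    first≤ : ∀ m π → Valid m π → first m π ≤ m
    first≤ m zeros        _           = ≤-refl
    first≤ m (tops _)     u<m         = <⇒≤ u<m
    first≤ m (flat _ _)   u<m         = <⇒≤ u<m
    first≤ m (rise _ _ _) (u<v , v<m) = <⇒≤ (<-trans u<v v<m)

    before-first : ∀ m π {t} → t < first m π → t < m → shape m π ! t ≡ bot
    before-first m zeros        t<u t<m = stairs-low m m m t<m t<u
    before-first m (tops u)     t<u t<m = stairs-low m u u t<m t<u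
    before-first m (flat p u)   t<u t<m = stairs-low m u u t<m t<u
    before-first m (rise p u v) t<u t<m = stairs-low m u v t<m t<u

    at-first : ∀ m π → Valid m π → first m π < m → shape m π ! first m π ≡ leading π
    at-first m zeros        _         m<m = ⊥-elim (n≮n m m<m)
    at-first m (tops u)     _         u<m = stairs-high m u u u<m ≤-refl ≤-refl
    at-first m (flat p u)   _         u<m = stairs-high m u u u<m ≤-refl ≤-refl
    at-first m (rise p u v) (u<v , _) u<m = stairs-mid m u v u<m ≤-refl u<v

    at-last : ∀ m π → Valid (suc m) π → first (suc m) π < suc m → shape (suc m) π ! m ≡ final π
    at-last m zeros        _          m<m  = ⊥-elim (n≮n _ m<m)
    at-last m (tops u)     _          u<m  = stairs-high (suc m) u u ≤-refl (≤-pred u<m) (≤-pred u<m)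
    at-last m (flat p u)   _          u<m  = stairs-high (suc m) u u ≤-refl (≤-pred u<m) (≤-pred u<m)
    at-last m (rise p u v) (_ , v<m)  u<m  = stairs-high (suc m) u v ≤-refl (≤-pred u<m) (≤-pred v<m)

    leading≢bot : ∀ m π → first m π < m → leading π ≢ bot
    leading≢bot m zeros        m<m = ⊥-elim (n≮n m m<m)
    leading≢bot m (tops _)     _   = λ ()
    leading≢bot m (flat p _)   _   = elem≢bot p
    leading≢bot m (rise p _ _) _   = elem≢bot p

    first-unique : ∀ m π π' → Valid m π → Valid m π' → shape m π ≡ shape m π' → first m π ≡ first m π'
    first-unique m π π' π-valid π'-valid π≡π' with <-cmp (first m π) (first m π')
    ... | tri≈ _ u≡u' _ = u≡u'
    ... | tri< u<u' _ _ = ⊥-elim (leading≢bot m π u<m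
          (trans (sym (at-first m π π-valid u<m)) (trans (cong (_! first m π) π≡π') (before-first m π' u<u' u<m))))
      where
      u<m : first m π < m
      u<m = <-≤-trans u<u' (first≤ m π' π'-valid)
    ... | tri> _ _ u'<u = ⊥-elim (leading≢bot m π' u'<m
          (trans (sym (at-first m π' π'-valid u'<m)) (trans (cong (_! first m π') (sym π≡π')) (before-first m π u'<u u'<m))))
      where
      u'<m : first m π' < m
      u'<m = <-≤-trans u'<u (first≤ m π π-valid)

  -- A valid shape is determined by the position and value of the first nonzero entry, the last
  -- entry and, for rise p u v, the position v where p turns into its upper cover.
  shape-injective : ∀ m π π' → Valid (suc m) π → Valid (suc m) π' → shape (suc m) π ≡ shape (suc m) π' → π ≡ π'
  shape-injective m π π' π-valid π'-valid π≡π' = go π π' π-valid π'-valid π≡π' (first-unique (suc m) π π' π-valid π'-valid π≡π')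
    where
    same-leading : ∀ π π' → Valid (suc m) π → Valid (suc m) π' → first (suc m) π ≡ first (suc m) π' →
                   first (suc m) π < suc m → shape (suc m) π ≡ shape (suc m) π' → leading π ≡ leading π'
    same-leading π π' π-valid π'-valid u≡u' u<m π≡π' =
      trans (sym (at-first (suc m) π π-valid u<m))
            (trans (cong (_! first (suc m) π) π≡π') (subst (λ t → shape (suc m) π' ! t ≡ leading π') (sym u≡u')
                   (at-first (suc m) π' π'-valid (subst (_< suc m) u≡u' u<m))))
    same-final : ∀ π π' → Valid (suc m) π → Valid (suc m) π' → first (suc m) π ≡ first (suc m) π' →
                 first (suc m) π < suc m → shape (suc m) π ≡ shape (suc m) π' → final π ≡ final π'
    same-final π π' π-valid π'-valid u≡u' u<m π≡π' =
      trans (sym (at-last m π π-valid u<m)) (trans (cong (_! m) π≡π') (at-last m π' π'-valid (subst (_< suc m) u≡u' u<m)))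
    go : ∀ π π' → Valid (suc m) π → Valid (suc m) π' → shape (suc m) π ≡ shape (suc m) π' → first (suc m) π ≡ first (suc m) π' → π ≡ π'
    go zeros        zeros          _ _ _ _ = refl
    go zeros        (tops _)       _ u<m _ refl = ⊥-elim (n≮n _ u<m)
    go zeros        (flat _ _)     _ u<m _ refl = ⊥-elim (n≮n _ u<m)
    go zeros        (rise _ _ _)   _ (u<v , v<m) _ refl = ⊥-elim (n≮n _ (<-trans u<v v<m))
    go (tops _)     zeros          u<m _ _ refl = ⊥-elim (n≮n _ u<m)
    go (flat _ _)   zeros          u<m _ _ refl = ⊥-elim (n≮n _ u<m)
    go (rise _ _ _) zeros          (u<v , v<m) _ _ refl = ⊥-elim (n≮n _ (<-trans u<v v<m))
    go (tops u)     (tops .u)      _ _ _ refl = refl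
    go (tops u)     (flat p .u)    π-valid π'-valid same refl =
      ⊥-elim (elem≢top p (sym (same-leading (tops u) (flat p u) π-valid π'-valid refl π-valid same)))
    go (tops u)     (rise p .u v)  π-valid π'-valid same refl =
      ⊥-elim (elem≢top p (sym (same-leading (tops u) (rise p u v) π-valid π'-valid refl π-valid same)))
    go (flat p u)   (tops .u)      π-valid π'-valid same refl =
      ⊥-elim (elem≢top p (same-leading (flat p u) (tops u) π-valid π'-valid refl π-valid same))
    go (rise p u v) (tops .u)      π-valid π'-valid same refl =
      ⊥-elim (elem≢top p (same-leading (rise p u v) (tops u) π-valid π'-valid refl (<-trans (proj₁ π-valid) (proj₂ π-valid)) same))
    go (flat p u)   (flat p' .u)   π-valid π'-valid same refl
      with elem-injective (same-leading (flat p u) (flat p' u) π-valid π'-valid refl π-valid same)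
    ... | refl = refl
    go (flat p u)   (rise p' .u v) π-valid π'-valid same refl
      with elem-injective (same-leading (flat p u) (rise p' u v) π-valid π'-valid refl π-valid same)
    ... | refl = ⊥-elim (proj₂ (elem⊏up p) (same-final (flat p u) (rise p u v) π-valid π'-valid refl π-valid same))
    go (rise p u v) (flat p' .u)   π-valid π'-valid same refl
      with elem-injective (same-leading (rise p u v) (flat p' u) π-valid π'-valid refl (<-trans (proj₁ π-valid) (proj₂ π-valid)) same)
    ... | refl = ⊥-elim (proj₂ (elem⊏up p)
                   (sym (same-final (rise p u v) (flat p u) π-valid π'-valid refl (<-trans (proj₁ π-valid) (proj₂ π-valid)) same)))
    go (rise p u v) (rise p' .u v') (u<v , v<m) (u<v' , v'<m) same refl
      with elem-injective (same-leading (rise p u v) (rise p' u v') (u<v , v<m) (u<v' , v'<m) refl (<-trans u<v v<m) same)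
    ... | refl with <-cmp v v'
    ...   | tri≈ _ refl _ = refl
    ...   | tri< v<v' _ _ = ⊥-elim (proj₂ (elem⊏up p) (sym
            (trans (sym (stairs-high (suc m) u v v<m (<⇒≤ u<v) ≤-refl))
                   (trans (cong (_! v) same) (stairs-mid (suc m) u v' v<m (<⇒≤ u<v) v<v')))))
    ...   | tri> _ _ v'<v = ⊥-elim (proj₂ (elem⊏up p) (sym
            (trans (sym (stairs-high (suc m) u v' v'<m (<⇒≤ u<v') ≤-refl))
                   (trans (cong (_! v') (sym same)) (stairs-mid (suc m) u v v'<m (<⇒≤ u<v') v'<v)))))

  propers : List (Proper k l)
  propers = map inj₁ (allFin k) ++ map inj₂ (allFin l)

  ∈-propers : ∀ p → p ∈ propers
  ∈-propers (inj₁ i) = ∈-++⁺ˡ (∈-map⁺ inj₁ (∈-allFin i))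
  ∈-propers (inj₂ j) = ∈-++⁺ʳ (map inj₁ (allFin k)) (∈-map⁺ inj₂ (∈-allFin j))

  propers-unique : Unique propers
  propers-unique = ++⁺ (map⁺ (λ { refl → refl }) (allFin⁺ k)) (map⁺ (λ { refl → refl }) (allFin⁺ l)) λ (p∈₁ , p∈₂) →
    case ∈-map⁻ inj₁ p∈₁ , ∈-map⁻ inj₂ p∈₂ of λ { ((_ , _ , refl) , (_ , _ , ())) }

  length-propers : length propers ≡ k + l
  length-propers = trans (length-++ (map inj₁ (allFin k)))
    (cong₂ _+_ (trans (length-map inj₁ (allFin k)) (length-tabulate {n = k} (λ i → i)))
               (trans (length-map inj₂ (allFin l)) (length-tabulate {n = l} (λ i → i))))

  tops-block flat-block rise-block shapes : ℕ → List (Shape)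
  tops-block m = map tops (upTo m)
  flat-block m = concatMap (λ p → map (flat p) (upTo m)) propers
  rise-block m = concatMap (λ p → concatMap (λ v → map (λ u → rise p u v) (upTo v)) (upTo m)) propers
  shapes     m = zeros ∷ tops-block m ++ flat-block m ++ rise-block m

  private
    ∈-tops-block⁻ : ∀ m {π} → π ∈ tops-block m → ∃[ u ] u < m × π ≡ tops u
    ∈-tops-block⁻ m π∈ = let u , u∈ , π≡ = ∈-map⁻ tops π∈ in u , ∈-upTo⁻ u∈ , π≡

    ∈-flat-block⁻ : ∀ m {π} → π ∈ flat-block m → ∃[ p ] ∃[ u ] u < m × π ≡ flat p u
    ∈-flat-block⁻ m π∈ =
      let p , _ , π∈p = find (∈-concatMap⁻ (λ p → map (flat p) (upTo m)) {xs = propers} π∈)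
          u , u∈ , π≡ = ∈-map⁻ _ π∈p
      in p , u , ∈-upTo⁻ u∈ , π≡

    ∈-rise-block⁻ : ∀ m {π} → π ∈ rise-block m → ∃[ p ] ∃[ u ] ∃[ v ] (u < v × v < m) × π ≡ rise p u v
    ∈-rise-block⁻ m π∈ =
      let p , _ , π∈p = find (∈-concatMap⁻ (λ p → concatMap (λ v → map (λ u → rise p u v) (upTo v)) (upTo m)) {xs = propers} π∈)
          v , v∈ , π∈pv = find (∈-concatMap⁻ (λ v → map (λ u → rise p u v) (upTo v)) {xs = upTo m} π∈p)
          u , u∈ , π≡ = ∈-map⁻ _ π∈pv
      in p , u , v , (∈-upTo⁻ u∈ , ∈-upTo⁻ v∈) , π≡

  ∈-shapes⁻ : ∀ {m π} → π ∈ shapes m → Valid m π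
  ∈-shapes⁻ (here refl) = tt
  ∈-shapes⁻ {m} (there π∈) with ∈-++⁻ (tops-block m) π∈
  ... | inj₁ π∈t with ∈-tops-block⁻ m π∈t
  ...   | _ , u<m , refl = u<m
  ∈-shapes⁻ {m} (there π∈) | inj₂ π∈fr with ∈-++⁻ (flat-block m) π∈fr
  ... | inj₁ π∈f with ∈-flat-block⁻ m π∈f
  ...   | _ , _ , u<m , refl = u<m
  ∈-shapes⁻ {m} (there π∈) | inj₂ π∈fr | inj₂ π∈r with ∈-rise-block⁻ m π∈r
  ... | _ , _ , _ , valid , refl = valid

  ∈-shapes⁺ : ∀ {m} π → Valid m π → π ∈ shapes m
  ∈-shapes⁺ zeros _ = here refl
  ∈-shapes⁺ (tops u) u<m = there (∈-++⁺ˡ (∈-map⁺ tops (∈-upTo⁺ u<m)))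
  ∈-shapes⁺ {m} (flat p u) u<m =
    there (∈-++⁺ʳ (tops-block m) (∈-++⁺ˡ (∈-concatMap⁺ _ (lose (∈-propers p) (∈-map⁺ (flat p) (∈-upTo⁺ u<m))))))
  ∈-shapes⁺ {m} (rise p u v) (u<v , v<m) =
    there (∈-++⁺ʳ (tops-block m) (∈-++⁺ʳ (flat-block m)
      (∈-concatMap⁺ _ (lose (∈-propers p) (∈-concatMap⁺ _ (lose (∈-upTo⁺ v<m) (∈-map⁺ (λ u → rise p u v) (∈-upTo⁺ u<v))))))))

  shapes-unique : ∀ m → Unique (shapes m)
  shapes-unique m =
    All.tabulate (λ π∈ → zeros∉ π∈) ∷ ++⁺ tops-unique (++⁺ flat-unique rise-unique flat∩rise) tops∩rest
    where
    zeros∉ : ∀ {π} → π ∈ tops-block m ++ flat-block m ++ rise-block m → zeros ≢ π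
    zeros∉ π∈ refl with ∈-++⁻ (tops-block m) π∈
    ... | inj₁ π∈t = case proj₂ (proj₂ (∈-tops-block⁻ m π∈t)) of λ ()
    ... | inj₂ π∈fr with ∈-++⁻ (flat-block m) π∈fr
    ...   | inj₁ π∈f = case proj₂ (proj₂ (proj₂ (∈-flat-block⁻ m π∈f))) of λ ()
    ...   | inj₂ π∈r = case proj₂ (proj₂ (proj₂ (proj₂ (∈-rise-block⁻ m π∈r)))) of λ ()
    tops-unique : Unique (tops-block m)
    tops-unique = map⁺ (λ { refl → refl }) (upTo⁺ m)
    flat-unique : Unique (flat-block m)
    flat-unique = concatMap-unique _ propers-unique (λ p → map⁺ (λ { refl → refl }) (upTo⁺ m)) λ π∈ π∈' →
      case ∈-map⁻ _ π∈ , ∈-map⁻ _ π∈' of λ { ((_ , _ , refl) , (_ , _ , refl)) → refl }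
    rise-unique : Unique (rise-block m)
    rise-unique = concatMap-unique _ propers-unique
      (λ p → concatMap-unique _ (upTo⁺ m) (λ v → map⁺ (λ { refl → refl }) (upTo⁺ v)) λ π∈ π∈' →
         case ∈-map⁻ _ π∈ , ∈-map⁻ _ π∈' of λ { ((_ , _ , refl) , (_ , _ , refl)) → refl })
      λ {p} {p'} π∈ π∈' → case find (∈-concatMap⁻ (λ v → map (λ u → rise p u v) (upTo v)) {xs = upTo m} π∈) ,
                               find (∈-concatMap⁻ (λ v → map (λ u → rise p' u v) (upTo v)) {xs = upTo m} π∈') of λ
        { ((_ , _ , π∈v) , (_ , _ , π∈v')) → case ∈-map⁻ _ π∈v , ∈-map⁻ _ π∈v' of λ
          { ((_ , _ , refl) , (_ , _ , refl)) → refl } }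
    flat∩rise : ∀ {π} → π ∈ flat-block m × π ∈ rise-block m → ⊥
    flat∩rise (π∈f , π∈r) with ∈-flat-block⁻ m π∈f | ∈-rise-block⁻ m π∈r
    ... | _ , _ , _ , refl | _ , _ , _ , _ , ()
    tops∩rest : ∀ {π} → π ∈ tops-block m × π ∈ flat-block m ++ rise-block m → ⊥
    tops∩rest (π∈t , π∈fr) with ∈-tops-block⁻ m π∈t | ∈-++⁻ (flat-block m) π∈fr
    ... | _ , _ , refl | inj₁ π∈f = case proj₂ (proj₂ (proj₂ (∈-flat-block⁻ m π∈f))) of λ ()
    ... | _ , _ , refl | inj₂ π∈r = case proj₂ (proj₂ (proj₂ (proj₂ (∈-rise-block⁻ m π∈r)))) of λ ()

  ∑-shapes : ∀ (f : Shape → ℕ) m → ∑ f (shapes m) ≡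
    f zeros + (∑ (f ∘ tops) (upTo m) + (∑ (λ p → ∑ (f ∘ flat p) (upTo m)) propers +
                                       ∑ (λ p → ∑ (λ v → ∑ (λ u → f (rise p u v)) (upTo v)) (upTo m)) propers))
  ∑-shapes f m = cong (f zeros +_) (trans (∑-++ f (tops-block m) _) (cong₂ _+_ (∑-map f tops (upTo m))
    (trans (∑-++ f (flat-block m) _) (cong₂ _+_
      (trans (∑-concatMap f _ propers) (∑-cong propers λ p _ → ∑-map f (flat p) (upTo m)))
      (trans (∑-concatMap f _ propers) (∑-cong propers λ p _ → trans (∑-concatMap f _ (upTo m))
        (∑-cong (upTo m) λ v _ → ∑-map f (λ u → rise p u v) (upTo v))))))))

module _ {k₀ l : ℕ} where
  open Cover (suc k₀) l

  antichain : List (Pkl (suc k₀) l)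
  antichain = map an (allFin l)

  ∈-antichain⁻ : ∀ {s} → s ∈ antichain → ∃[ j ] s ≡ an j
  ∈-antichain⁻ s∈ = let j , _ , s≡ = ∈-map⁻ an s∈ in j , s≡

  length-antichain : length antichain ≡ l
  length-antichain = trans (length-map an (allFin l)) (length-tabulate {n = l} (λ i → i))

  unique-with-head : ∀ {h} → (∀ j → h ≢ an j) → Unique (h ∷ antichain)
  unique-with-head h≢an = All.tabulate (λ s∈ → let j , s≡ = ∈-antichain⁻ s∈ in h≢an j ∘ flip trans s≡)
                          ∷ map⁺ (λ { refl → refl }) (allFin⁺ l)

  atoms coatoms : List (Pkl (suc k₀) l)
  atoms   = ch fzero ∷ antichain
  coatoms = ch (fromℕ k₀) ∷ antichain

  atoms-unique : Unique atoms
  atoms-unique = unique-with-head (λ _ ())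

  coatoms-unique : Unique coatoms
  coatoms-unique = unique-with-head (λ _ ())

  atom-⋖ : ∀ {a} → a ∈ atoms → bot ⋖ a
  atom-⋖ (here refl) = down-⋖ (inj₁ fzero)
  atom-⋖ (there a∈) with ∈-antichain⁻ a∈
  ... | j , refl = down-⋖ (inj₂ j)

  atom-below : ∀ {s} → s ≢ bot → ∃[ a ] a ∈ atoms × a ≼ s
  atom-below {bot}  s≢bot = ⊥-elim (s≢bot refl)
  atom-below {top}  _     = ch fzero , here refl , ≼top
  atom-below {ch j} _     = ch fzero , here refl , ch≼ch z≤n
  atom-below {an j} _     = an j , there (∈-map⁺ an (∈-allFin j)) , an≼an

  atoms-antichain : ∀ {a a'} → a ∈ atoms → a' ∈ atoms → a ≼ a' → a ≡ a'
  atoms-antichain a∈ a'∈ a≼a' = ⋖-above (atom-⋖ a'∈) (proj₁ (atom-⋖ a∈)) a≼a'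

  up-last : up {l = l} (inj₁ (fromℕ k₀)) ≡ top
  up-last with suc (toℕ (fromℕ k₀)) <? suc k₀
  ... | yes k₀+1<k = ⊥-elim (n≮n k₀ (subst (_< k₀) (toℕ-fromℕ k₀) (≤-pred k₀+1<k)))
  ... | no _       = refl

  coatom-⋖ : ∀ {r} → r ∈ coatoms → r ⋖ top
  coatom-⋖ (here refl) = subst (ch (fromℕ k₀) ⋖_) up-last (up-⋖ (inj₁ (fromℕ k₀)))
  coatom-⋖ (there r∈) with ∈-antichain⁻ r∈
  ... | j , refl = up-⋖ (inj₂ j)

  coatom≢bot : ∀ {r} → r ∈ coatoms → r ≢ bot
  coatom≢bot (here refl) ()
  coatom≢bot (there r∈) r≡bot with ∈-antichain⁻ r∈
  ... | j , refl = case r≡bot of λ ()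

  coatom-above : ∀ {s} → s ≢ top → ∃[ r ] r ∈ coatoms × s ≼ r
  coatom-above {top}  s≢top = ⊥-elim (s≢top refl)
  coatom-above {bot}  _     = ch (fromℕ k₀) , here refl , bot≼
  coatom-above {ch j} _     = ch (fromℕ k₀) , here refl ,
                              ch≼ch (subst (toℕ j ≤_) (sym (toℕ-fromℕ k₀)) (≤-pred (toℕ<n j)))
  coatom-above {an j} _     = an j , there (∈-map⁺ an (∈-allFin j)) , an≼an

  ⋖top⇒coatom : ∀ {s} → s ⋖ top → s ∈ coatoms
  ⋖top⇒coatom {s} s⋖top with coatom-above (proj₂ (proj₁ s⋖top))
  ... | r , r∈ , s≼r = subst (_∈ coatoms) (⋖-below s⋖top s≼r (proj₁ (coatom-⋖ r∈))) r∈

  coatoms-antichain : ∀ {r r'} → r ∈ coatoms → r' ∈ coatoms → r ≼ r' → r ≡ r'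
  coatoms-antichain r∈ r'∈ r≼r' = sym (⋖-below (coatom-⋖ r∈) r≼r' (proj₁ (coatom-⋖ r'∈)))

  -- Upper covers of the staircases

  upper-zeros : ∀ m' → numUpperCovers (suc m') (shape (suc m') zeros) ≡ suc l
  upper-zeros m' = trans (numUpperCovers≡length covers) (trans (length-map f atoms) (cong suc length-antichain))
    where
    m : ℕ
    m = suc m'
    x : Vec (Pkl (suc k₀) l) m
    x = shape m zeros
    f : Pkl (suc k₀) l → Vec (Pkl (suc k₀) l) m
    f a = stairs m m' m' bot a
    f-last : ∀ a → f a ! m' ≡ a
    f-last a = stairs-high m m' m' ≤-refl ≤-refl ≤-refl
    dominated : ∀ y → InQ y → x ⊏ᵥ y → ∃[ a ] a ∈ atoms × f a ⊑ᵥ y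
    dominated y y∈Q x⊏y = case y ! m' ≟ bot of λ where
      (yes y-last≡bot) → ⊥-elim (⊏ᵥ⇒⋢ᵥ x⊏y λ t t<m →
        subst (y ! t ≼_) (trans y-last≡bot (sym (stairs-low m m m t<m t<m))) (InQ⇒monotone y y∈Q t m' (≤-pred t<m) ≤-refl))
      (no y-last≢bot)  → let a , a∈ , a≼ = atom-below y-last≢bot in
        a , a∈ , stairs⊑ᵥ y (InQ⇒monotone y y∈Q) m' m' (λ m'<m' → ⊥-elim (n≮n _ m'<m')) (λ _ → a≼)
    covers : MinimalAbove x (map f atoms)
    covers = minimalAbove-image f atoms-unique
      (λ a∈ → stairs∈Q m m' m' (inj₁ refl) , zeros-least (f _) ,
              ≢-at m' (λ e → proj₂ (proj₁ (atom-⋖ a∈)) (trans (sym (stairs-low m m m ≤-refl ≤-refl)) (trans e (f-last _)))))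
      (λ a∈ a'∈ fa'⊑fa → atoms-antichain a'∈ a∈ (subst₂ _≼_ (f-last _) (f-last _) (fa'⊑fa m' ≤-refl)))
      dominated

  upper-tops₀ : ∀ m' → numUpperCovers (suc m') (shape (suc m') (tops 0)) ≡ 0
  upper-tops₀ m' = numUpperCovers≡length {x = shape (suc m') (tops 0)} (minimalAbove-[] λ y _ x⊏y → ⊏ᵥ⇒⋢ᵥ x⊏y (tops-greatest y))

  upper-tops : ∀ m' u' → suc u' ≤ m' → numUpperCovers (suc m') (shape (suc m') (tops (suc u'))) ≡ suc l
  upper-tops m' u' u≤m' = trans (numUpperCovers≡length covers) (trans (length-map f coatoms) (cong suc length-antichain))
    where
    m : ℕ
    m = suc m'
    u : ℕ
    u = suc u'
    x : Vec (Pkl (suc k₀) l) m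
    x = shape m (tops u)
    u<m : u < m
    u<m = s≤s u≤m'
    u'<m : u' < m
    u'<m = ≤-trans u≤m' (n≤1+n m')
    f : Pkl (suc k₀) l → Vec (Pkl (suc k₀) l) m
    f r = stairs m u' u r top
    f-at-u' : ∀ r → f r ! u' ≡ r
    f-at-u' r = stairs-mid m u' u u'<m ≤-refl ≤-refl
    top≼f-at-u : ∀ r → top ≼ f r ! u
    top≼f-at-u r = subst (top ≼_) (sym (stairs-high m u' u u<m (n≤1+n _) ≤-refl)) ≼top
    x-at-u' : x ! u' ≡ bot
    x-at-u' = stairs-low m u u u'<m ≤-refl
    above : ∀ {r} → r ∈ coatoms → InQ (f r) × x ⊏ᵥ f r
    above {r} r∈ = f∈Q , stairs⊑ᵥ (f r) (InQ⇒monotone (f r) f∈Q) u u (λ u<u → ⊥-elim (n≮n _ u<u)) (λ _ → top≼f-at-u r) ,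
                   ≢-at u' (λ e → coatom≢bot r∈ (trans (sym (f-at-u' r)) (trans (sym e) x-at-u')))
      where
      f∈Q : InQ (f r)
      f∈Q = stairs∈Q m u' u (inj₂ (inj₂ (coatom-⋖ r∈)))
    dominated : ∀ y → InQ y → x ⊏ᵥ y → ∃[ r ] r ∈ coatoms × f r ⊑ᵥ y
    dominated y y∈Q x⊏y = cases (y ! u' ≟ bot) (y ! u' ≟ top)
      where
      y↑ : Monotone y
      y↑ = InQ⇒monotone y y∈Q
      y-u≡top : y ! u ≡ top
      y-u≡top = ≼-antisym ≼top (subst (_≼ y ! u) (stairs-high m u u u<m ≤-refl ≤-refl) (proj₁ x⊏y u u<m))
      top≼y-u : top ≼ y ! u
      top≼y-u = subst (top ≼_) (sym y-u≡top) ≼top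
      cases : Dec (y ! u' ≡ bot) → Dec (y ! u' ≡ top) → ∃[ r ] r ∈ coatoms × f r ⊑ᵥ y
      cases (yes y-u'≡bot) _ = ⊥-elim (⊏ᵥ⇒⋢ᵥ x⊏y
        (⊑ᵥstairs y y↑ u u (<⇒≤ u<m) (monotone-below y y↑ u'<m y-u'≡bot) (λ _ u<u → ⊥-elim (n≮n _ u<u)) ≼top))
      cases (no _) (yes y-u'≡top) =
        ch (fromℕ k₀) , here refl , stairs⊑ᵥ y y↑ u' u (λ _ _ → subst (_ ≼_) (sym y-u'≡top) ≼top) (λ _ → top≼y-u)
      cases (no y-u'≢bot) (no y-u'≢top) =
        y ! u' , ⋖top⇒coatom (subst (y ! u' ⋖_) y-u≡top y-u'⋖y-u) , stairs⊑ᵥ y y↑ u' u (λ _ _ → ≼-refl) (λ _ → top≼y-u)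
        where
        y-u'⋖y-u : y ! u' ⋖ y ! u
        y-u'⋖y-u = InQ⇒stepsAreCovers y y∈Q u' u (n≤1+n _) u<m y-u'≢bot (λ e → y-u'≢top (trans e y-u≡top))
    covers : MinimalAbove x (map f coatoms)
    covers = minimalAbove-image f coatoms-unique above
      (λ r∈ r'∈ fr'⊑fr → coatoms-antichain r'∈ r∈ (subst₂ _≼_ (f-at-u' _) (f-at-u' _) (fr'⊑fr u' u'<m)))
      dominated

  private
    module Flat (m' : ℕ) (p : Proper (suc k₀) l) (u : ℕ) (u≤m' : u ≤ m') where
      m : ℕ
      m = suc m'
      P : Pkl (suc k₀) l
      P = elem p
      x : Vec (Pkl (suc k₀) l) m
      x = shape m (flat p u)
      c₁ : Vec (Pkl (suc k₀) l) m
      c₁ = stairs m u m' P (up p)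

      u<m : u < m
      u<m = s≤s u≤m'

      x-from-u : ∀ {t} → u ≤ t → t < m → x ! t ≡ P
      x-from-u u≤t t<m = stairs-high m u u t<m u≤t u≤t

      c₁∈Q : InQ c₁
      c₁∈Q = stairs∈Q m u m' (inj₂ (inj₂ (up-⋖ p)))

      P≼c₁-from-u : ∀ {t} → u ≤ t → t < m → P ≼ c₁ ! t
      P≼c₁-from-u {t} u≤t t<m = case region u m' t of λ where
        (low t<u)       → ⊥-elim (n≮n t (<-≤-trans t<u u≤t))
        (mid u≤t t<m')  → subst (P ≼_) (sym (stairs-mid m u m' t<m u≤t t<m')) ≼-refl
        (high u≤t m'≤t) → subst (P ≼_) (sym (stairs-high m u m' t<m u≤t m'≤t)) (proj₁ (elem⊏up p))

      x⊏c₁ : x ⊏ᵥ c₁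
      x⊏c₁ = stairs⊑ᵥ c₁ (InQ⇒monotone c₁ c₁∈Q) u u (λ u<u → ⊥-elim (n≮n _ u<u)) (λ _ → P≼c₁-from-u ≤-refl u<m) ,
             ≢-at m' (λ e → proj₂ (elem⊏up p) (trans (sym (x-from-u u≤m' ≤-refl)) (trans e (stairs-high m u m' ≤-refl u≤m' ≤-refl))))

      c₁⊑ᵥ : ∀ y → InQ y → x ⊑ᵥ y → y ! m' ≢ P → c₁ ⊑ᵥ y
      c₁⊑ᵥ y y∈Q x⊑y y-last≢P = stairs⊑ᵥ y (InQ⇒monotone y y∈Q) u m'
        (λ _ _ → subst (_≼ y ! u) (x-from-u ≤-refl u<m) (x⊑y u u<m))
        (λ _ → up-least p (subst (_≼ y ! m') (x-from-u u≤m' ≤-refl) (x⊑y m' ≤-refl) , y-last≢P ∘ sym))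

      ⊑ᵥx : ∀ y → InQ y → y ! m' ≡ P → (∀ {t} → t < u → y ! t ≡ bot) → y ⊑ᵥ x
      ⊑ᵥx y y∈Q y-last≡P below-u = ⊑ᵥstairs y (InQ⇒monotone y y∈Q) u u (<⇒≤ u<m) below-u
        (λ _ u<u → ⊥-elim (n≮n _ u<u)) (subst (_≼ P) (sym y-last≡P) ≼-refl)

  upper-flat₀ : ∀ m' p → numUpperCovers (suc m') (shape (suc m') (flat p 0)) ≡ 1
  upper-flat₀ m' p = numUpperCovers≡length {x = x} (minimalAbove-[ c₁∈Q , x⊏c₁ ] least)
    where
    open Flat m' p 0 z≤n
    least : ∀ y → InQ y → x ⊏ᵥ y → c₁ ⊑ᵥ y
    least y y∈Q x⊏y = case y ! m' ≟ P of λ where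
      (yes y-last≡P) → ⊥-elim (⊏ᵥ⇒⋢ᵥ x⊏y (⊑ᵥx y y∈Q y-last≡P λ ()))
      (no y-last≢P)  → c₁⊑ᵥ y y∈Q (proj₁ x⊏y) y-last≢P

  -- The second upper cover turns the last 0̂ into the lower cover of p (into p itself when p is an atom).
  upper-flat : ∀ m' p u' → suc u' ≤ m' → numUpperCovers (suc m') (shape (suc m') (flat p (suc u'))) ≡ 2
  upper-flat m' p u' u≤m' = numUpperCovers≡length {x = x}
    (minimalAbove-pair (c₁∈Q , x⊏c₁) (c₂∈Q , x⊏c₂) c₁⋢c₂ c₂⋢c₁ dominated)
    where
    open Flat m' p (suc u') u≤m'
    c₂ : Vec (Pkl (suc k₀) l) m
    c₂ = stairs m u' (suc u') (lower p) P
    c₂∈Q : InQ c₂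
    c₂∈Q = stairs∈Q m u' (suc u') (inj₂ (lower-cases p))
    u'<m : u' < m
    u'<m = ≤-trans (n≤1+n _) u<m
    c₂-at-u' : c₂ ! u' ≡ lower p
    c₂-at-u' = stairs-mid m u' (suc u') u'<m ≤-refl ≤-refl
    c₂-from-u : ∀ {t} → suc u' ≤ t → t < m → c₂ ! t ≡ P
    c₂-from-u u≤t t<m = stairs-high m u' (suc u') t<m (≤-trans (n≤1+n _) u≤t) u≤t
    x⊏c₂ : x ⊏ᵥ c₂
    x⊏c₂ = stairs⊑ᵥ c₂ (InQ⇒monotone c₂ c₂∈Q) (suc u') (suc u') (λ u<u → ⊥-elim (n≮n _ u<u))
             (λ _ → subst (P ≼_) (sym (c₂-from-u ≤-refl u<m)) ≼-refl) ,
           ≢-at u' (λ e → lower≢bot p (trans (sym c₂-at-u') (trans (sym e) (stairs-low m (suc u') (suc u') u'<m ≤-refl))))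
    c₁⋢c₂ : ¬ c₁ ⊑ᵥ c₂
    c₁⋢c₂ c₁⊑c₂ = proj₂ (elem⊏up p) (≼-antisym (proj₁ (elem⊏up p))
      (subst₂ _≼_ (stairs-high m (suc u') m' ≤-refl u≤m' ≤-refl) (c₂-from-u u≤m' ≤-refl) (c₁⊑c₂ m' ≤-refl)))
    c₂⋢c₁ : ¬ c₂ ⊑ᵥ c₁
    c₂⋢c₁ c₂⊑c₁ = lower≢bot p (≼-antisym (subst₂ _≼_ c₂-at-u' (stairs-low m (suc u') m' u'<m ≤-refl) (c₂⊑c₁ u' u'<m)) bot≼)
    dominated : ∀ y → InQ y → x ⊏ᵥ y → c₁ ⊑ᵥ y ⊎ c₂ ⊑ᵥ y
    dominated y y∈Q x⊏y = cases (y ! m' ≟ P) (y ! u' ≟ bot) (y ! u' ≟ P)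
      where
      y↑ : Monotone y
      y↑ = InQ⇒monotone y y∈Q
      P≼y-u : P ≼ y ! suc u'
      P≼y-u = subst (_≼ y ! suc u') (x-from-u ≤-refl u<m) (proj₁ x⊏y (suc u') u<m)
      cases : Dec (y ! m' ≡ P) → Dec (y ! u' ≡ bot) → Dec (y ! u' ≡ P) → c₁ ⊑ᵥ y ⊎ c₂ ⊑ᵥ y
      cases (no y-last≢P)  _               _               = inj₁ (c₁⊑ᵥ y y∈Q (proj₁ x⊏y) y-last≢P)
      cases (yes y-last≡P) (yes y-u'≡bot)  _               =
        ⊥-elim (⊏ᵥ⇒⋢ᵥ x⊏y (⊑ᵥx y y∈Q y-last≡P (monotone-below y y↑ u'<m y-u'≡bot)))
      cases (yes y-last≡P) (no _)          (yes y-u'≡P)    =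
        inj₂ (stairs⊑ᵥ y y↑ u' (suc u') (λ _ _ → subst (lower p ≼_) (sym y-u'≡P) (lower≼elem p)) (λ _ → P≼y-u))
      cases (yes y-last≡P) (no y-u'≢bot)   (no y-u'≢P)     =
        inj₂ (stairs⊑ᵥ y y↑ u' (suc u') (λ _ _ → subst (lower p ≼_) (sym y-u'≡down) (⊑-reflexive (lower≡down p (y-u'≢bot ∘ trans y-u'≡down))))
                                          (λ _ → P≼y-u))
        where
        -- y ! u' < P = y ! m' is a cover, so y ! u' is the lower cover of p.
        y-u'≡down : y ! u' ≡ down p
        y-u'≡down = ⋖⇒≡down p (subst (y ! u' ⋖_) y-last≡P
          (InQ⇒stepsAreCovers y y∈Q u' m' (≤-trans (n≤1+n _) u≤m') ≤-refl y-u'≢bot (y-u'≢P ∘ flip trans y-last≡P)))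

  private
    module Rise (m' : ℕ) (p : Proper (suc k₀) l) (u w : ℕ) (u≤w : u ≤ w) (w<m' : suc w ≤ m') where
      m : ℕ
      m = suc m'
      v : ℕ
      v = suc w
      P : Pkl (suc k₀) l
      P = elem p
      Q : Pkl (suc k₀) l
      Q = up p
      x : Vec (Pkl (suc k₀) l) m
      x = shape m (rise p u v)
      c₁ : Vec (Pkl (suc k₀) l) m
      c₁ = stairs m u w P Q

      P⊏Q : P ⊏ Q
      P⊏Q = elem⊏up p
      v<m : v < m
      v<m = s≤s w<m'
      w<m : w < m
      w<m = ≤-trans (n≤1+n _) v<m
      u<m : u < m
      u<m = ≤-<-trans u≤w w<m
      u<v : u < v
      u<v = s≤s u≤w
      w≤m' : w ≤ m'
      w≤m' = ≤-trans (n≤1+n _) w<m'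

      x-mid : ∀ {t} → u ≤ t → t < v → x ! t ≡ P
      x-mid u≤t t<v = stairs-mid m u v (<-trans t<v v<m) u≤t t<v

      x-high : ∀ {t} → v ≤ t → t < m → x ! t ≡ Q
      x-high v≤t t<m = stairs-high m u v t<m (≤-trans (<⇒≤ u<v) v≤t) v≤t

      c₁∈Q : InQ c₁
      c₁∈Q = stairs∈Q m u w (inj₂ (inj₂ (up-⋖ p)))

      c₁-at-w : c₁ ! w ≡ Q
      c₁-at-w = stairs-high m u w w<m u≤w ≤-refl

      P≼c₁-from-u : ∀ {t} → u ≤ t → t < m → P ≼ c₁ ! t
      P≼c₁-from-u {t} u≤t t<m = case region u w t of λ where
        (low t<u)      → ⊥-elim (n≮n t (<-≤-trans t<u u≤t))
        (mid u≤t t<w)  → subst (P ≼_) (sym (stairs-mid m u w t<m u≤t t<w)) ≼-refl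
        (high u≤t w≤t) → subst (P ≼_) (sym (stairs-high m u w t<m u≤t w≤t)) (proj₁ P⊏Q)

      x⊏c₁ : x ⊏ᵥ c₁
      x⊏c₁ = stairs⊑ᵥ c₁ (InQ⇒monotone c₁ c₁∈Q) u v (λ _ _ → P≼c₁-from-u ≤-refl u<m)
               (λ _ → subst (Q ≼_) (sym (stairs-high m u w v<m (<⇒≤ u<v) (n≤1+n _))) ≼-refl) ,
             ≢-at w (λ e → proj₂ P⊏Q (trans (sym (x-mid u≤w ≤-refl)) (trans e c₁-at-w)))

      c₁⊑ᵥ : ∀ y → InQ y → x ⊑ᵥ y → y ! w ≢ P → c₁ ⊑ᵥ y
      c₁⊑ᵥ y y∈Q x⊑y y-w≢P = stairs⊑ᵥ y (InQ⇒monotone y y∈Q) u w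
        (λ _ _ → subst (_≼ y ! u) (x-mid ≤-refl u<v) (x⊑y u u<m))
        (λ _ → up-least p (subst (_≼ y ! w) (x-mid u≤w ≤-refl) (x⊑y w w<m) , y-w≢P ∘ sym))

      y-last≡Q : ∀ y → InQ y → x ⊑ᵥ y → y ! w ≡ P → y ! m' ≡ Q
      y-last≡Q y y∈Q x⊑y y-w≡P = ⋖⇒≡up p (subst (_⋖ y ! m') y-w≡P
        (InQ⇒stepsAreCovers y y∈Q w m' w≤m' ≤-refl (elem≢bot p ∘ trans (sym y-w≡P)) y-w≢y-last))
        where
        Q≼y-last : Q ≼ y ! m'
        Q≼y-last = subst (_≼ y ! m') (x-high w<m' ≤-refl) (x⊑y m' ≤-refl)
        y-w≢y-last : y ! w ≢ y ! m'
        y-w≢y-last e = proj₂ P⊏Q (≼-antisym (proj₁ P⊏Q) (subst (Q ≼_) (trans (sym e) y-w≡P) Q≼y-last))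

      ⊑ᵥx : ∀ y → InQ y → x ⊑ᵥ y → y ! w ≡ P → (∀ {t} → t < u → y ! t ≡ bot) → y ⊑ᵥ x
      ⊑ᵥx y y∈Q x⊑y y-w≡P below-u = ⊑ᵥstairs y (InQ⇒monotone y y∈Q) u v (<⇒≤ v<m) below-u
        (λ { refl _ → subst (_≼ P) (sym y-w≡P) ≼-refl }) (subst (_≼ Q) (sym (y-last≡Q y y∈Q x⊑y y-w≡P)) ≼-refl)

  upper-rise₀ : ∀ m' p w → suc w ≤ m' → numUpperCovers (suc m') (shape (suc m') (rise p 0 (suc w))) ≡ 1
  upper-rise₀ m' p w w<m' = numUpperCovers≡length {x = x} (minimalAbove-[ c₁∈Q , x⊏c₁ ] least)
    where
    open Rise m' p 0 w z≤n w<m'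
    least : ∀ y → InQ y → x ⊏ᵥ y → c₁ ⊑ᵥ y
    least y y∈Q x⊏y = case y ! w ≟ P of λ where
      (yes y-w≡P) → ⊥-elim (⊏ᵥ⇒⋢ᵥ x⊏y (⊑ᵥx y y∈Q (proj₁ x⊏y) y-w≡P λ ()))
      (no y-w≢P)  → c₁⊑ᵥ y y∈Q (proj₁ x⊏y) y-w≢P

  upper-rise : ∀ m' p u' w → suc u' ≤ w → suc w ≤ m' → numUpperCovers (suc m') (shape (suc m') (rise p (suc u') (suc w))) ≡ 2
  upper-rise m' p u' w u≤w w<m' = numUpperCovers≡length {x = x}
    (minimalAbove-pair (c₁∈Q , x⊏c₁) (c₂∈Q , x⊏c₂) c₁⋢c₂ c₂⋢c₁ dominated)
    where
    open Rise m' p (suc u') w u≤w w<m'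
    c₂ : Vec (Pkl (suc k₀) l) m
    c₂ = stairs m u' v P Q
    c₂∈Q : InQ c₂
    c₂∈Q = stairs∈Q m u' v (inj₂ (inj₂ (up-⋖ p)))
    u'<m : u' < m
    u'<m = ≤-trans (n≤1+n _) u<m
    c₂-mid : ∀ {t} → u' ≤ t → t < v → c₂ ! t ≡ P
    c₂-mid u'≤t t<v = stairs-mid m u' v (<-trans t<v v<m) u'≤t t<v
    x⊏c₂ : x ⊏ᵥ c₂
    x⊏c₂ = stairs⊑ᵥ c₂ (InQ⇒monotone c₂ c₂∈Q) (suc u') v (λ _ _ → subst (P ≼_) (sym (c₂-mid (n≤1+n _) u<v)) ≼-refl)
             (λ _ → subst (Q ≼_) (sym (stairs-high m u' v v<m (≤-trans (n≤1+n _) (<⇒≤ u<v)) ≤-refl)) ≼-refl) ,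
           ≢-at u' (λ e → elem≢bot p (trans (sym (c₂-mid ≤-refl (≤-trans (n≤1+n _) u<v))) (trans (sym e) (stairs-low m (suc u') v u'<m ≤-refl))))
    c₁⋢c₂ : ¬ c₁ ⊑ᵥ c₂
    c₁⋢c₂ c₁⊑c₂ = proj₂ P⊏Q (≼-antisym (proj₁ P⊏Q) (subst₂ _≼_ c₁-at-w (c₂-mid (≤-trans (n≤1+n _) u≤w) ≤-refl) (c₁⊑c₂ w w<m)))
    c₂⋢c₁ : ¬ c₂ ⊑ᵥ c₁
    c₂⋢c₁ c₂⊑c₁ = elem≢bot p (≼-antisym
      (subst₂ _≼_ (c₂-mid ≤-refl (≤-trans (n≤1+n _) u<v)) (stairs-low m (suc u') w u'<m ≤-refl) (c₂⊑c₁ u' u'<m)) bot≼)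
    dominated : ∀ y → InQ y → x ⊏ᵥ y → c₁ ⊑ᵥ y ⊎ c₂ ⊑ᵥ y
    dominated y y∈Q (x⊑y , x≢y) = cases (y ! w ≟ P) (y ! u' ≟ bot)
      where
      y↑ : Monotone y
      y↑ = InQ⇒monotone y y∈Q
      cases : Dec (y ! w ≡ P) → Dec (y ! u' ≡ bot) → c₁ ⊑ᵥ y ⊎ c₂ ⊑ᵥ y
      cases (no y-w≢P)  _              = inj₁ (c₁⊑ᵥ y y∈Q x⊑y y-w≢P)
      cases (yes y-w≡P) (yes y-u'≡bot) =
        ⊥-elim (⊏ᵥ⇒⋢ᵥ (x⊑y , x≢y) (⊑ᵥx y y∈Q x⊑y y-w≡P (monotone-below y y↑ u'<m y-u'≡bot)))
      cases (yes y-w≡P) (no y-u'≢bot)  =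
        inj₂ (stairs⊑ᵥ y y↑ u' v (λ _ _ → P≼y-u') (λ _ → subst (_≼ y ! v) (x-high ≤-refl v<m) (x⊑y v v<m)))
        where
        y-u'≼P : y ! u' ≼ P
        y-u'≼P = subst (y ! u' ≼_) y-w≡P (y↑ u' w (≤-trans (n≤1+n _) u≤w) w<m)
        y-last : y ! m' ≡ Q
        y-last = y-last≡Q y y∈Q x⊑y y-w≡P
        -- y ! u' < P would make y ! u' ⋖ Q = y ! m' with P strictly between.
        P≼y-u' : P ≼ y ! u'
        P≼y-u' = case y ! u' ≟ P of λ where
          (yes y-u'≡P) → subst (P ≼_) (sym y-u'≡P) ≼-refl
          (no y-u'≢P)  → ⊥-elim (proj₂ P⊏Q (⋖-above
            (subst (y ! u' ⋖_) y-last (InQ⇒stepsAreCovers y y∈Q u' m' (≤-trans (n≤1+n _) (≤-trans u≤w w≤m')) ≤-refl y-u'≢bot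
               (λ e → proj₂ P⊏Q (≼-antisym (proj₁ P⊏Q) (subst (_≼ P) (trans e y-last) y-u'≼P)))))
            (y-u'≼P , y-u'≢P) (proj₁ P⊏Q)))

  -- Lower covers of the staircases

  lower-zeros : ∀ m → numLowerCovers m (shape m zeros) ≡ 0
  lower-zeros m = numLowerCovers≡length {x = shape m zeros} (maximalBelow-[] λ y _ y⊏x → ⊏ᵥ⇒⋢ᵥ y⊏x (zeros-least y))

  lower-tops : ∀ m' u → u ≤ m' → numLowerCovers (suc m') (shape (suc m') (tops u)) ≡ suc l
  lower-tops m' u u≤m' = trans (numLowerCovers≡length covers) (trans (length-map f coatoms) (cong suc length-antichain))
    where
    m : ℕ
    m = suc m'
    x : Vec (Pkl (suc k₀) l) m
    x = shape m (tops u)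
    u<m : u < m
    u<m = s≤s u≤m'
    f : Pkl (suc k₀) l → Vec (Pkl (suc k₀) l) m
    f r = stairs m u (suc u) r top
    f-at-u : ∀ r → f r ! u ≡ r
    f-at-u r = stairs-mid m u (suc u) u<m ≤-refl ≤-refl
    x-from-u : ∀ {t} → u ≤ t → t < m → x ! t ≡ top
    x-from-u u≤t t<m = stairs-high m u u t<m u≤t u≤t
    below : ∀ {r} → r ∈ coatoms → InQ (f r) × f r ⊏ᵥ x
    below {r} r∈ = stairs∈Q m u (suc u) (inj₂ (inj₂ (coatom-⋖ r∈))) ,
      stairs⊑ᵥ x (InQ⇒monotone x (shape∈Q m (tops u))) u (suc u)
        (λ _ _ → subst (r ≼_) (sym (x-from-u ≤-refl u<m)) ≼top) (λ 1+u<m → subst (top ≼_) (sym (x-from-u (n≤1+n _) 1+u<m)) ≼top) ,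
      ≢-at u (λ e → proj₂ (proj₁ (coatom-⋖ r∈)) (trans (sym (f-at-u r)) (trans e (x-from-u ≤-refl u<m))))
    dominating : ∀ y → InQ y → y ⊏ᵥ x → ∃[ r ] r ∈ coatoms × y ⊑ᵥ f r
    dominating y y∈Q y⊏x = case y ! u ≟ top of λ where
      (yes y-u≡top) → ⊥-elim (⊏ᵥ⇒⋢ᵥ y⊏x (stairs⊑ᵥ y (InQ⇒monotone y y∈Q) u u (λ u<u → ⊥-elim (n≮n _ u<u))
                                             (λ _ → subst (top ≼_) (sym y-u≡top) ≼top)))
      (no y-u≢top)  → let r , r∈ , y-u≼r = coatom-above y-u≢top in
        r , r∈ , ⊑ᵥstairs y (InQ⇒monotone y y∈Q) u (suc u) u<m
                   (λ t<u → ⊑ᵥ-0̂ {y = y} {x} (proj₁ y⊏x) (<-trans t<u u<m) (stairs-low m u u (<-trans t<u u<m) t<u))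
                   (λ { refl _ → y-u≼r }) ≼top
    covers : MaximalBelow x (map f coatoms)
    covers = maximalBelow-image f coatoms-unique below
      (λ r∈ r'∈ fr⊑fr' → coatoms-antichain r∈ r'∈ (subst₂ _≼_ (f-at-u _) (f-at-u _) (fr⊑fr' u u<m)))
      dominating

  lower-flat : ∀ m' p u → u ≤ m' → numLowerCovers (suc m') (shape (suc m') (flat p u)) ≡ 1
  lower-flat m' p u u≤m' = numLowerCovers≡length {x = x} (maximalBelow-[ c∈Q , c⊏x ] greatest)
    where
    m : ℕ
    m = suc m'
    P : Pkl (suc k₀) l
    P = elem p
    x : Vec (Pkl (suc k₀) l) m
    x = shape m (flat p u)
    c : Vec (Pkl (suc k₀) l) m
    c = stairs m u (suc u) (down p) P
    c∈Q : InQ c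
    c∈Q = stairs∈Q m u (suc u) (inj₂ (inj₂ (down-⋖ p)))
    u<m : u < m
    u<m = s≤s u≤m'
    x-from-u : ∀ {t} → u ≤ t → t < m → x ! t ≡ P
    x-from-u u≤t t<m = stairs-high m u u t<m u≤t u≤t
    c⊏x : c ⊏ᵥ x
    c⊏x = stairs⊑ᵥ x (InQ⇒monotone x (shape∈Q m (flat p u))) u (suc u)
            (λ _ _ → subst (down p ≼_) (sym (x-from-u ≤-refl u<m)) (proj₁ (down⊏elem p)))
            (λ 1+u<m → subst (P ≼_) (sym (x-from-u (n≤1+n _) 1+u<m)) ≼-refl) ,
          ≢-at u (λ e → proj₂ (down⊏elem p) (trans (sym (stairs-mid m u (suc u) u<m ≤-refl ≤-refl)) (trans e (x-from-u ≤-refl u<m))))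
    greatest : ∀ y → InQ y → y ⊏ᵥ x → y ⊑ᵥ c
    greatest y y∈Q y⊏x = case y ! u ≟ P of λ where
      (yes y-u≡P) → ⊥-elim (⊏ᵥ⇒⋢ᵥ y⊏x (stairs⊑ᵥ y (InQ⇒monotone y y∈Q) u u (λ u<u → ⊥-elim (n≮n _ u<u))
                                           (λ _ → subst (P ≼_) (sym y-u≡P) ≼-refl)))
      (no y-u≢P)  → ⊑ᵥstairs y (InQ⇒monotone y y∈Q) u (suc u) u<m
        (λ t<u → ⊑ᵥ-0̂ {y = y} {x} (proj₁ y⊏x) (<-trans t<u u<m) (stairs-low m u u (<-trans t<u u<m) t<u))
        (λ { refl _ → down-greatest p (subst (y ! u ≼_) (x-from-u ≤-refl u<m) (proj₁ y⊏x u u<m) , y-u≢P) })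
        (subst (y ! m' ≼_) (x-from-u u≤m' ≤-refl) (proj₁ y⊏x m' ≤-refl))

  lower-rise : ∀ m' p u v → u < v → v ≤ m' → numLowerCovers (suc m') (shape (suc m') (rise p u v)) ≡ 2
  lower-rise m' p u v u<v v≤m' = numLowerCovers≡length {x = x}
    (maximalBelow-pair (c₁∈Q , c₁⊏x) (c₂∈Q , c₂⊏x) c₁⋢c₂ c₂⋢c₁ dominating)
    where
    m : ℕ
    m = suc m'
    P : Pkl (suc k₀) l
    P = elem p
    Q : Pkl (suc k₀) l
    Q = up p
    P⊏Q : P ⊏ Q
    P⊏Q = elem⊏up p
    x : Vec (Pkl (suc k₀) l) m
    x = shape m (rise p u v)
    c₁ : Vec (Pkl (suc k₀) l) m
    c₁ = stairs m (suc u) v P Q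
    c₂ : Vec (Pkl (suc k₀) l) m
    c₂ = stairs m u (suc v) P Q
    c₁∈Q : InQ c₁
    c₁∈Q = stairs∈Q m (suc u) v (inj₂ (inj₂ (up-⋖ p)))
    c₂∈Q : InQ c₂
    c₂∈Q = stairs∈Q m u (suc v) (inj₂ (inj₂ (up-⋖ p)))
    x↑ : Monotone x
    x↑ = InQ⇒monotone x (shape∈Q m (rise p u v))
    v<m : v < m
    v<m = s≤s v≤m'
    u<m : u < m
    u<m = <-trans u<v v<m
    x-mid : ∀ {t} → u ≤ t → t < v → x ! t ≡ P
    x-mid u≤t t<v = stairs-mid m u v (<-trans t<v v<m) u≤t t<v
    x-high : ∀ {t} → v ≤ t → t < m → x ! t ≡ Q
    x-high v≤t t<m = stairs-high m u v t<m (≤-trans (<⇒≤ u<v) v≤t) v≤t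
    c₁-at-u : c₁ ! u ≡ bot
    c₁-at-u = stairs-low m (suc u) v u<m ≤-refl
    c₂-at-u : c₂ ! u ≡ P
    c₂-at-u = stairs-mid m u (suc v) u<m ≤-refl (≤-trans u<v (n≤1+n _))
    c₂-at-v : c₂ ! v ≡ P
    c₂-at-v = stairs-mid m u (suc v) v<m (<⇒≤ u<v) ≤-refl
    c₁⊏x : c₁ ⊏ᵥ x
    c₁⊏x = stairs⊑ᵥ x x↑ (suc u) v (λ 1+u<v _ → subst (P ≼_) (sym (x-mid (n≤1+n _) 1+u<v)) ≼-refl)
             (λ _ → subst (Q ≼_) (sym (x-high ≤-refl v<m)) ≼-refl) ,
           ≢-at u (λ e → elem≢bot p (trans (sym (x-mid ≤-refl u<v)) (trans (sym e) c₁-at-u)))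
    c₂⊏x : c₂ ⊏ᵥ x
    c₂⊏x = stairs⊑ᵥ x x↑ u (suc v) (λ _ _ → subst (P ≼_) (sym (x-mid ≤-refl u<v)) ≼-refl)
             (λ 1+v<m → subst (Q ≼_) (sym (x-high (n≤1+n _) 1+v<m)) ≼-refl) ,
           ≢-at v (λ e → proj₂ P⊏Q (trans (sym c₂-at-v) (trans e (x-high ≤-refl v<m))))
    c₁⋢c₂ : ¬ c₁ ⊑ᵥ c₂
    c₁⋢c₂ c₁⊑c₂ = proj₂ P⊏Q (≼-antisym (proj₁ P⊏Q)
      (subst₂ _≼_ (stairs-high m (suc u) v v<m u<v ≤-refl) c₂-at-v (c₁⊑c₂ v v<m)))
    c₂⋢c₁ : ¬ c₂ ⊑ᵥ c₁
    c₂⋢c₁ c₂⊑c₁ = elem≢bot p (≼-antisym (subst₂ _≼_ c₂-at-u c₁-at-u (c₂⊑c₁ u u<m)) bot≼)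
    dominating : ∀ y → InQ y → y ⊏ᵥ x → y ⊑ᵥ c₁ ⊎ y ⊑ᵥ c₂
    dominating y y∈Q (y⊑x , y≢x) = case y ! u ≟ bot of λ where
        (yes y-u≡bot) → inj₁ (⊑ᵥstairs y y↑ (suc u) v (<⇒≤ v<m) (monotone-below y y↑ u<m y-u≡bot) y-before-v≼P y-last≼Q)
        (no y-u≢bot)  → inj₂ (⊑ᵥstairs y y↑ u (suc v) v<m
                                (λ t<u → ⊑ᵥ-0̂ {y = y} {x} y⊑x (<-trans t<u u<m) (stairs-low m u v (<-trans t<u u<m) t<u))
                                (λ { refl _ → y-v≼P y-u≢bot (y ! u ≟ P) (y ! u ≟ y ! v) (y ! v ≟ Q) }) y-last≼Q)
      where
      y↑ : Monotone y
      y↑ = InQ⇒monotone y y∈Q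
      y-last≼Q : y ! m' ≼ Q
      y-last≼Q = subst (y ! m' ≼_) (x-high v≤m' ≤-refl) (y⊑x m' ≤-refl)
      y-before-v≼P : ∀ {v'} → v ≡ suc v' → suc u < v → y ! v' ≼ P
      y-before-v≼P {v'} v≡1+v' _ = subst (y ! v' ≼_) (x-mid (≤-pred (subst (u <_) v≡1+v' u<v)) v'<v) (y⊑x v' (<-trans v'<v v<m))
        where
        v'<v : v' < v
        v'<v = subst (v' <_) (sym v≡1+v') ≤-refl
      y-u≼P : y ! u ≼ P
      y-u≼P = subst (y ! u ≼_) (x-mid ≤-refl u<v) (y⊑x u u<m)
      -- If y ! u < P, then y ! u ⋖ y ! v forces y ! v ≤ P.
      y-v≼P : y ! u ≢ bot → Dec (y ! u ≡ P) → Dec (y ! u ≡ y ! v) → Dec (y ! v ≡ Q) → y ! v ≼ P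
      y-v≼P _ (yes y-u≡P) _ (yes y-v≡Q) =
        ⊥-elim (⊏ᵥ⇒⋢ᵥ (y⊑x , y≢x) (stairs⊑ᵥ y y↑ u v (λ _ _ → subst (P ≼_) (sym y-u≡P) ≼-refl) (λ _ → subst (Q ≼_) (sym y-v≡Q) ≼-refl)))
      y-v≼P _ (yes y-u≡P) _ (no y-v≢Q) =
        ⊑-reflexive (⋖-below (up-⋖ p) (subst (_≼ y ! v) y-u≡P (y↑ u v (<⇒≤ u<v) v<m))
                                      (subst (y ! v ≼_) (x-high ≤-refl v<m) (y⊑x v v<m) , y-v≢Q))
      y-v≼P _ (no _) (yes y-u≡y-v) _ = subst (_≼ P) y-u≡y-v y-u≼P
      y-v≼P y-u≢bot (no y-u≢P) (no y-u≢y-v) _ =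
        ⋖⇒≼-above p y-u≢bot (y-u≼P , y-u≢P) (InQ⇒stepsAreCovers y y∈Q u v (<⇒≤ u<v) v<m y-u≢bot y-u≢y-v)

  upperCount lowerCount : Shape {suc k₀} {l} → ℕ
  upperCount zeros            = suc l
  upperCount (tops zero)      = 0
  upperCount (tops (suc _))   = suc l
  upperCount (flat _ zero)    = 1
  upperCount (flat _ (suc _)) = 2
  upperCount (rise _ zero _)  = 1
  upperCount (rise _ (suc _) _) = 2

  lowerCount zeros        = 0
  lowerCount (tops _)     = suc l
  lowerCount (flat _ _)   = 1
  lowerCount (rise _ _ _) = 2

  numUpperCovers-shape : ∀ m' π → Valid (suc m') π → numUpperCovers (suc m') (shape (suc m') π) ≡ upperCount π
  numUpperCovers-shape m' zeros              _           = upper-zeros m'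
  numUpperCovers-shape m' (tops zero)        _           = upper-tops₀ m'
  numUpperCovers-shape m' (tops (suc u))     u<m         = upper-tops m' u (≤-pred u<m)
  numUpperCovers-shape m' (flat p zero)      _           = upper-flat₀ m' p
  numUpperCovers-shape m' (flat p (suc u))   u<m         = upper-flat m' p u (≤-pred u<m)
  numUpperCovers-shape m' (rise p zero (suc w))    (_ , v<m)   = upper-rise₀ m' p w (≤-pred v<m)
  numUpperCovers-shape m' (rise p (suc u) (suc w)) (u<v , v<m) = upper-rise m' p u w (≤-pred u<v) (≤-pred v<m)

  numLowerCovers-shape : ∀ m' π → Valid (suc m') π → numLowerCovers (suc m') (shape (suc m') π) ≡ lowerCount π
  numLowerCovers-shape m' zeros        _           = lower-zeros (suc m')
  numLowerCovers-shape m' (tops u)     u<m         = lower-tops m' u (≤-pred u<m)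
  numLowerCovers-shape m' (flat p u)   u<m         = lower-flat m' p u (≤-pred u<m)
  numLowerCovers-shape m' (rise p u v) (u<v , v<m) = lower-rise m' p u v u<v (≤-pred v<m)

  coefficient≡∑-shapes : ∀ m' n (g : Vec (Pkl (suc k₀) l) (suc m') → ℕ) (count : Shape {suc k₀} {l} → ℕ) →
    (∀ π → Valid (suc m') π → g (shape (suc m') π) ≡ count π) →
    length (filter (λ x → T? (g x ≡ᵇ n)) (coverPoset (suc m'))) ≡ ∑ (λ π → [ n ≡? count π ]) (shapes (suc m'))
  coefficient≡∑-shapes m' n g count g≡count = begin
    length (filter (λ x → T? (g x ≡ᵇ n)) (coverPoset m))
      ≡⟨ length-filter-coverPoset (map (shape m) (shapes m)) Q-unique Q-complete (λ x → g x ≡ᵇ n) ⟩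
    ∑ (λ x → if g x ≡ᵇ n then 1 else 0) (map (shape m) (shapes m))
      ≡⟨ ∑-map (λ x → if g x ≡ᵇ n then 1 else 0) (shape m) (shapes m) ⟩
    ∑ (λ π → if g (shape m π) ≡ᵇ n then 1 else 0) (shapes m)
      ≡⟨ ∑-cong (shapes m) (λ π π∈ → cong (λ c → if c ≡ᵇ n then 1 else 0) (g≡count π (∈-shapes⁻ π∈))) ⟩
    ∑ (λ π → if count π ≡ᵇ n then 1 else 0) (shapes m)
      ≡⟨ ∑-cong (shapes m) (λ π _ → cong (λ b → if b then 1 else 0) (≡ᵇ-comm (count π) n)) ⟩
    ∑ (λ π → [ n ≡? count π ]) (shapes m) ∎
    where
    open ≡-Reasoning
    m : ℕ
    m = suc m'
    Q-unique : Unique (map (shape m) (shapes m))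
    Q-unique = map-unique (shape m) (shapes-unique m)
                 (λ {π} {π'} π∈ π'∈ → shape-injective m' π π' (∈-shapes⁻ π∈) (∈-shapes⁻ π'∈))
    Q-complete : ∀ {x} → x ∈ map (shape m) (shapes m) ⇔ InQ x
    Q-complete {x} = mk⇔ (λ x∈ → let π , _ , x≡ = ∈-map⁻ (shape m) {xs = shapes m} x∈ in subst InQ (sym x≡) (shape∈Q m π))
                         (λ x∈Q → let π , π-valid , x≡ = classify m x x∈Q in subst (_∈ _) (sym x≡) (∈-map⁺ (shape m) (∈-shapes⁺ π π-valid)))

  UF-Pkl≡∑ : ∀ m' n → UF-Pkl (suc k₀) l (suc m') n ≡ ∑ (λ π → [ n ≡? upperCount π ]) (shapes (suc m'))
  UF-Pkl≡∑ m' n = coefficient≡∑-shapes m' n (numUpperCovers (suc m')) upperCount (numUpperCovers-shape m')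

  LF-Pkl≡∑ : ∀ m' n → LF-Pkl (suc k₀) l (suc m') n ≡ ∑ (λ π → [ n ≡? lowerCount π ]) (shapes (suc m'))
  LF-Pkl≡∑ m' n = coefficient≡∑-shapes m' n (numLowerCovers (suc m')) lowerCount (numLowerCovers-shape m')

  ∑-propers : ∀ (g : Proper (suc k₀) l → ℕ) c → (∀ p → g p ≡ c) → ∑ g propers ≡ (suc k₀ + l) * c
  ∑-propers g c g≡c =
    trans (∑-cong propers (λ p _ → g≡c p)) (trans (∑-const c (propers {suc k₀} {l})) (cong (_* c) (length-propers {suc k₀} {l})))

  module _ (m' n : ℕ) where
    private
      K a₀ a₁ a₂ aₗ : ℕ
      K  = suc k₀ + l
      a₀ = [ n ≡? 0 ]
      a₁ = [ n ≡? 1 ]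
      a₂ = [ n ≡? 2 ]
      aₗ = [ n ≡? suc l ]
      aₗ≡ : aₗ ≡ [ n ≡? l + 1 ]
      aₗ≡ = cong [ n ≡?_] (+-comm 1 l)
      rhs : ℕ → ℕ → ℕ
      rhs c₂ aₗ₊₁ = a₀ * 1 + a₁ * (K * suc m') + a₂ * (K * c₂) + aₗ₊₁ * suc m'
      open ≡-Reasoning

    ∑-upperCount≡rhsCoeff : ∑ (λ π → [ n ≡? upperCount π ]) (shapes {suc k₀} {l} (suc m')) ≡ rhsCoeff (suc k₀) l (suc m') n
    ∑-upperCount≡rhsCoeff = begin
      ∑ (λ π → [ n ≡? upperCount π ]) (shapes {suc k₀} {l} (suc m'))
        ≡⟨ trans (∑-shapes (λ π → [ n ≡? upperCount π ]) (suc m')) (cong (aₗ +_) (cong₂ _+_ tops-sum (cong₂ _+_ flat-sum rise-sum))) ⟩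
      aₗ + ((a₀ + m' * aₗ) + (K * (a₁ + m' * a₂) + K * (m' * a₁ + (m' C 2) * a₂)))
        ≡⟨ normal a₀ a₁ a₂ aₗ K m' (m' C 2) ⟩
      rhs (m' + m' C 2) aₗ
        ≡⟨ cong₂ rhs (sym (suc-C2 m')) aₗ≡ ⟩
      rhsCoeff (suc k₀) l (suc m') n ∎
      where
      tops-sum : ∑ (λ u → [ n ≡? upperCount (tops u) ]) (upTo (suc m')) ≡ a₀ + m' * aₗ
      tops-sum = trans (∑-upTo-suc (λ u → [ n ≡? upperCount (tops u) ]) m') (cong (a₀ +_) (∑-upTo-const aₗ m'))
      flat-sum : ∑ (λ p → ∑ (λ u → [ n ≡? upperCount (flat p u) ]) (upTo (suc m'))) propers ≡ K * (a₁ + m' * a₂)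
      flat-sum = ∑-propers _ _ λ p →
        trans (∑-upTo-suc (λ u → [ n ≡? upperCount (flat p u) ]) m') (cong (a₁ +_) (∑-upTo-const a₂ m'))
      rise-sum : ∑ (λ p → ∑ (λ v → ∑ (λ u → [ n ≡? upperCount (rise p u v) ]) (upTo v)) (upTo (suc m'))) propers ≡
                 K * (m' * a₁ + (m' C 2) * a₂)
      rise-sum = ∑-propers _ _ λ p → trans (∑-upTo-suc (λ v → ∑ (λ u → [ n ≡? upperCount (rise p u v) ]) (upTo v)) m')
        (trans (∑-cong (upTo m') λ w _ → trans (∑-upTo-suc (λ u → [ n ≡? upperCount (rise p u (suc w)) ]) w)
                                                (cong (a₁ +_) (∑-upTo-const a₂ w)))
               (∑-upTo-linear a₁ a₂ m'))
      normal : ∀ a₀ a₁ a₂ aₗ K m' c → aₗ + ((a₀ + m' * aₗ) + (K * (a₁ + m' * a₂) + K * (m' * a₁ + c * a₂))) ≡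
                                      a₀ * 1 + a₁ * (K * suc m') + a₂ * (K * (m' + c)) + aₗ * suc m'
      normal = solve-∀

    ∑-lowerCount≡rhsCoeff : ∑ (λ π → [ n ≡? lowerCount π ]) (shapes {suc k₀} {l} (suc m')) ≡ rhsCoeff (suc k₀) l (suc m') n
    ∑-lowerCount≡rhsCoeff = begin
      ∑ (λ π → [ n ≡? lowerCount π ]) (shapes {suc k₀} {l} (suc m'))
        ≡⟨ trans (∑-shapes (λ π → [ n ≡? lowerCount π ]) (suc m')) (cong (a₀ +_) (cong₂ _+_ tops-sum (cong₂ _+_ flat-sum rise-sum))) ⟩
      a₀ + (suc m' * aₗ + (K * (suc m' * a₁) + K * (suc m' * 0 + (suc m' C 2) * a₂)))
        ≡⟨ normal a₀ a₁ a₂ aₗ K m' (suc m' C 2) ⟩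
      rhs (suc m' C 2) aₗ
        ≡⟨ cong (rhs (suc m' C 2)) aₗ≡ ⟩
      rhsCoeff (suc k₀) l (suc m') n ∎
      where
      tops-sum : ∑ (λ u → [ n ≡? lowerCount (tops u) ]) (upTo (suc m')) ≡ suc m' * aₗ
      tops-sum = ∑-upTo-const aₗ (suc m')
      flat-sum : ∑ (λ p → ∑ (λ u → [ n ≡? lowerCount (flat p u) ]) (upTo (suc m'))) (propers {suc k₀} {l}) ≡ K * (suc m' * a₁)
      flat-sum = ∑-propers (λ p → ∑ (λ u → [ n ≡? lowerCount (flat p u) ]) (upTo (suc m'))) _ λ p → ∑-upTo-const a₁ (suc m')
      rise-sum : ∑ (λ p → ∑ (λ v → ∑ (λ u → [ n ≡? lowerCount (rise p u v) ]) (upTo v)) (upTo (suc m'))) (propers {suc k₀} {l}) ≡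
                 K * (suc m' * 0 + (suc m' C 2) * a₂)
      rise-sum = ∑-propers (λ p → ∑ (λ v → ∑ (λ u → [ n ≡? lowerCount (rise p u v) ]) (upTo v)) (upTo (suc m'))) _ λ p →
        trans (∑-cong (upTo (suc m')) λ v _ → ∑-upTo-const a₂ v) (∑-upTo-linear 0 a₂ (suc m'))
      normal : ∀ a₀ a₁ a₂ aₗ K m' d → a₀ + (suc m' * aₗ + (K * (suc m' * a₁) + K * (suc m' * 0 + d * a₂))) ≡
                                      a₀ * 1 + a₁ * (K * suc m') + a₂ * (K * d) + aₗ * suc m'
      normal = solve-∀

proposition2p13 : (k l m : ℕ) → 0 < k → 0 < l → 0 < m → (n : ℕ) → (UF-Pkl k l m n ≡ rhsCoeff k l m n) × (LF-Pkl k l m n ≡ rhsCoeff k l m n)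
proposition2p13 (suc k₀) l (suc m') _ _ _ n =
  trans (UF-Pkl≡∑ m' n) (∑-upperCount≡rhsCoeff m' n) , trans (LF-Pkl≡∑ m' n) (∑-lowerCount≡rhsCoeff m' n)
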